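{- For pure formulae $G_1,\dots,G_m,F$ of a first-order language, $G_1,\dots,G_m\rhd_c^= F$ if and only if every $tv$-valuation with equality of $\mathcal L(G_1,\dots,G_m,F)$ that $tv$-satisfies $G_1,\dots,G_m$ also $tv$-satisfies $F$.
   Context: A first-order language $\mathcal L$ has: a countable supply of variables (used for quantification), an infinite supply of individual parameters (free names that are never bound), constants, function symbols, relation symbols, the equality symbol $=$ and $\bot$. A term is pure if no variable occurs in it; a formula is pure if no variable occurs free in it. $F\{x/t\}$ denotes substitution; $\forall(\cdot)$ denotes universal closure. $\mathcal L(G_1,\dots,G_m,F)$ is the language whose constant, function and relation symbols are those occurring in the given formulae (with $=$, $\bot$ and all individual parameters). $N_c$ is the usual (Gentzen/Prawitz) natural deduction system for classical first-order logic, except that $\forall$-elimination (from $\forall x F$ infer $F\{x/\mathbf y\}$) and $\exists$-introduction (from $F\{x/\mathbf y\}$ infer $\exists x F$) are restricted to $\mathbf y$ a free variable or an individual parameter. $N_c^=$ is $N_c$ in which any formula $\forall(t=t)$ ($t$ parameter-free) or $\forall(r=s\rightarrow(F\{v/r\}\rightarrow F\{v/s\}))$ ($r,s,F$ parameter-free) may be used as a discharged assumption; $G_1,\dots,G_m\rhd_c^= F$ means there is a deduction in $N_c^=$ of $F$ with open assumptions among $G_1,\dots,G_m$. A $tv$-valuation of $\mathcal L$ is a total function $v$ from the pure atomic formulae of $\mathcal L$ to $\{\mathbf t,\mathbf f\}$ with $v(\bot)=\mathbf f$; it extends uniquely to $\bar v$ on pure formulae by the classical truth tables and: $\bar v(\forall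 x H)=\mathbf t$ iff $\bar v(H\{x/a\})=\mathbf t$ for every individual parameter $a$, $\bar v(\exists x H)=\mathbf t$ iff this holds for some parameter $a$. $v$ $tv$-satisfies pure $F$ if $\bar v(F)=\mathbf t$. A $tv$-valuation with equality is a $tv$-valuation satisfying all sentences of the forms $\forall(t=t)$, $\forall(r=s\rightarrow s=r)$, $\forall(r=s\rightarrow(s=t\rightarrow r=t))$, $\forall(r_1=s_1\wedge\dots\wedge r_n=s_n\rightarrow(p(r_1,\dots,r_n)\rightarrow p(s_1,\dots,s_n)))$ and $\forall(r_1=s_1\wedge\dots\wedge r_n=s_n\rightarrow f(r_1,\dots,r_n)=f(s_1,\dots,s_n))$ for all relation symbols $p$ and function symbols $f$ of $\mathcal L$ and parameter-free terms; equivalently, the relation $r=^v s:\iff v(r=s)=\mathbf t$ on pure terms is a congruence with respect to all function symbols and all relations $\{(t_1,\dots,t_n): v(p(t_1,\dots,t_n))=\mathbf t\}$. -}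

module Defs where

open import Data.Nat using (ℕ; zero; suc; _⊔_; _≡ᵇ_)
open import Data.Bool using (Bool; true; false; T; not; if_then_else_)
open import Data.Vec using (Vec; []; _∷_)
open import Data.Vec.Relation.Unary.All as VAll using ()
open import Data.Vec.Relation.Binary.Pointwise.Inductive using (Pointwise)
open import Data.List using (List; []; _∷_; _++_; filterᵇ; deduplicateᵇ; foldr)
open import Data.List.Membership.Propositional using (_∈_)
open import Data.List.Relation.Unary.Any using (Any)
open import Data.Product using (Σ; _×_; _,_)
open import Data.Sum using (_⊎_)
open import Data.Empty using (⊥)
open import Data.Unit using (⊤)
open import Relation.Nullary using (¬_)
open import Relation.Binary.PropositionalEquality using (_≡_)

record Signature : Set₁ where
  field
    Const    : Set
    Fun      : Set
    funArity : Fun → ℕ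
    Rel      : Set
    relArity : Rel → ℕ

module Syntax (Sig : Signature) where
  open Signature Sig

  Var : Set
  Var = ℕ

  Par : Set
  Par = ℕ

  data Term : Set where
    var : Var → Term
    par : Par → Term
    con : Const → Term
    fun : (f : Fun) → Vec Term (funArity f) → Term

  data Atom : Set where
    rel  : (p : Rel) → Vec Term (relArity p) → Atom
    _≐_  : Term → Term → Atom

  data Formula : Set where
    atom : Atom → Formula
    ⊥f   : Formula
    _∧f_ : Formula → Formula → Formula
    _∨f_ : Formula → Formula → Formula
    _⇒f_ : Formula → Formula → Formula
    ∀f   : Var → Formula → Formula
    ∃f   : Var → Formula → Formula

  ¬f : Formula → Formula
  ¬f F = F ⇒f ⊥f

  mutual
    substT : Var → Term → Term → Term
    substT x t (var y) = if x ≡ᵇ y then t else var y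
    substT x t (par a) = par a
    substT x t (con c) = con c
    substT x t (fun f ts) = fun f (substTs x t ts)

    substTs : ∀ {n} → Var → Term → Vec Term n → Vec Term n
    substTs x t [] = []
    substTs x t (s ∷ ss) = substT x t s ∷ substTs x t ss

  substA : Var → Term → Atom → Atom
  substA x t (rel p ts) = rel p (substTs x t ts)
  substA x t (r ≐ s) = substT x t r ≐ substT x t s

  substF : Var → Term → Formula → Formula
  substF x t (atom A) = atom (substA x t A)
  substF x t ⊥f = ⊥f
  substF x t (F ∧f G) = substF x t F ∧f substF x t G
  substF x t (F ∨f G) = substF x t F ∨f substF x t G
  substF x t (F ⇒f G) = substF x t F ⇒f substF x t G
  substF x t (∀f y H) = if x ≡ᵇ y then ∀f y H else ∀f y (substF x t H)
  substF x t (∃f y H) = if x ≡ᵇ y then ∃f y H else ∃f y (substF x t H)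

  mutual
    VarInT : Var → Term → Set
    VarInT x (var y) = x ≡ y
    VarInT x (par a) = ⊥
    VarInT x (con c) = ⊥
    VarInT x (fun f ts) = VarInTs x ts

    VarInTs : ∀ {n} → Var → Vec Term n → Set
    VarInTs x [] = ⊥
    VarInTs x (s ∷ ss) = VarInT x s ⊎ VarInTs x ss

  mutual
    ParInT : Par → Term → Set
    ParInT a (var y) = ⊥
    ParInT a (par b) = a ≡ b
    ParInT a (con c) = ⊥
    ParInT a (fun f ts) = ParInTs a ts

    ParInTs : ∀ {n} → Par → Vec Term n → Set
    ParInTs a [] = ⊥
    ParInTs a (s ∷ ss) = ParInT a s ⊎ ParInTs a ss

  VarInA : Var → Atom → Set
  VarInA x (rel p ts) = VarInTs x ts
  VarInA x (r ≐ s) = VarInT x r ⊎ VarInT x s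

  ParInA : Par → Atom → Set
  ParInA a (rel p ts) = ParInTs a ts
  ParInA a (r ≐ s) = ParInT a r ⊎ ParInT a s

  FreeF : Var → Formula → Set
  FreeF x (atom A) = VarInA x A
  FreeF x ⊥f = ⊥
  FreeF x (F ∧f G) = FreeF x F ⊎ FreeF x G
  FreeF x (F ∨f G) = FreeF x F ⊎ FreeF x G
  FreeF x (F ⇒f G) = FreeF x F ⊎ FreeF x G
  FreeF x (∀f y H) = ¬ (x ≡ y) × FreeF x H
  FreeF x (∃f y H) = ¬ (x ≡ y) × FreeF x H

  ParInF : Par → Formula → Set
  ParInF a (atom A) = ParInA a A
  ParInF a ⊥f = ⊥
  ParInF a (F ∧f G) = ParInF a F ⊎ ParInF a G
  ParInF a (F ∨f G) = ParInF a F ⊎ ParInF a G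
  ParInF a (F ⇒f G) = ParInF a F ⊎ ParInF a G
  ParInF a (∀f y H) = ParInF a H
  ParInF a (∃f y H) = ParInF a H

  PureT : Term → Set
  PureT t = ∀ x → ¬ VarInT x t

  PureF : Formula → Set
  PureF F = ∀ x → ¬ FreeF x F

  ParFreeT : Term → Set
  ParFreeT t = ∀ a → ¬ ParInT a t

  ParFreeF : Formula → Set
  ParFreeF F = ∀ a → ¬ ParInF a F

  FreeFor : Term → Var → Formula → Set
  FreeFor t x (atom A) = ⊤
  FreeFor t x ⊥f = ⊤
  FreeFor t x (F ∧f G) = FreeFor t x F × FreeFor t x G
  FreeFor t x (F ∨f G) = FreeFor t x F × FreeFor t x G
  FreeFor t x (F ⇒f G) = FreeFor t x F × FreeFor t x G
  FreeFor t x (∀f y H) = (FreeF x (∀f y H) → ¬ VarInT y t) × FreeFor t x H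
  FreeFor t x (∃f y H) = (FreeF x (∃f y H) → ¬ VarInT y t) × FreeFor t x H

  mutual
    fvT : Term → List Var
    fvT (var y) = y ∷ []
    fvT (par a) = []
    fvT (con c) = []
    fvT (fun f ts) = fvTs ts

    fvTs : ∀ {n} → Vec Term n → List Var
    fvTs [] = []
    fvTs (s ∷ ss) = fvT s ++ fvTs ss

  fvA : Atom → List Var
  fvA (rel p ts) = fvTs ts
  fvA (r ≐ s) = fvT r ++ fvT s

  fvF : Formula → List Var
  fvF (atom A) = fvA A
  fvF ⊥f = []
  fvF (F ∧f G) = fvF F ++ fvF G
  fvF (F ∨f G) = fvF F ++ fvF G
  fvF (F ⇒f G) = fvF F ++ fvF G
  fvF (∀f y H) = filterᵇ (λ z → not (y ≡ᵇ z)) (fvF H)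
  fvF (∃f y H) = filterᵇ (λ z → not (y ≡ᵇ z)) (fvF H)

  closure : Formula → Formula
  closure F = foldr ∀f F (deduplicateᵇ _≡ᵇ_ (fvF F))

  data Name : Set where
    nvar : Var → Name
    npar : Par → Name

  nameT : Name → Term
  nameT (nvar y) = var y
  nameT (npar a) = par a

  OccN : Name → Formula → Set
  OccN (nvar y) F = FreeF y F
  OccN (npar a) F = ParInF a F

  -- the equality axioms usable as discharged assumptions
  data EqAxiom : Formula → Set where
    ax-refl : ∀ t → ParFreeT t → EqAxiom (closure (atom (t ≐ t)))
    ax-subst : ∀ r s v F → ParFreeT r → ParFreeT s → ParFreeF F →
               FreeFor r v F → FreeFor s v F →
               EqAxiom (closure (atom (r ≐ s) ⇒f (substF v r F ⇒f substF v s F)))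

  Ctx : Set
  Ctx = List Formula

  NotInCtx : Name → Ctx → Set
  NotInCtx y Γ = ∀ G → G ∈ Γ → ¬ OccN y G

  data _⊢_ : Ctx → Formula → Set where
    hyp  : ∀ {Γ F} → F ∈ Γ → Γ ⊢ F
    eqax : ∀ {Γ F} → EqAxiom F → Γ ⊢ F
    ∧I   : ∀ {Γ F G} → Γ ⊢ F → Γ ⊢ G → Γ ⊢ (F ∧f G)
    ∧E₁  : ∀ {Γ F G} → Γ ⊢ (F ∧f G) → Γ ⊢ F
    ∧E₂  : ∀ {Γ F G} → Γ ⊢ (F ∧f G) → Γ ⊢ G
    ∨I₁  : ∀ {Γ F G} → Γ ⊢ F → Γ ⊢ (F ∨f G)
    ∨I₂  : ∀ {Γ F G} → Γ ⊢ G → Γ ⊢ (F ∨f G)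
    ∨E   : ∀ {Γ F G H} → Γ ⊢ (F ∨f G) → (F ∷ Γ) ⊢ H → (G ∷ Γ) ⊢ H → Γ ⊢ H
    ⇒I   : ∀ {Γ F G} → (F ∷ Γ) ⊢ G → Γ ⊢ (F ⇒f G)
    ⇒E   : ∀ {Γ F G} → Γ ⊢ (F ⇒f G) → Γ ⊢ F → Γ ⊢ G
    raa  : ∀ {Γ F} → (¬f F ∷ Γ) ⊢ ⊥f → Γ ⊢ F
    ∀I   : ∀ {Γ x F} (y : Name) → FreeFor (nameT y) x F →
           ¬ OccN y (∀f x F) → NotInCtx y Γ →
           Γ ⊢ substF x (nameT y) F → Γ ⊢ ∀f x F
    ∀E   : ∀ {Γ x F} (y : Name) → FreeFor (nameT y) x F →
           Γ ⊢ ∀f x F → Γ ⊢ substF x (nameT y) F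
    ∃I   : ∀ {Γ x F} (y : Name) → FreeFor (nameT y) x F →
           Γ ⊢ substF x (nameT y) F → Γ ⊢ ∃f x F
    ∃E   : ∀ {Γ x F G} (y : Name) → FreeFor (nameT y) x F →
           ¬ OccN y (∃f x F) → ¬ OccN y G → NotInCtx y Γ →
           Γ ⊢ ∃f x F → (substF x (nameT y) F ∷ Γ) ⊢ G → Γ ⊢ G

  -- a tv-valuation: truth values of (pure) atomic formulae; v(⊥) = f is
  -- built into the evaluation below.
  Valuation : Set
  Valuation = Atom → Bool

  height : Formula → ℕ
  height (atom A) = 0
  height ⊥f = 0
  height (F ∧f G) = suc (height F ⊔ height G)
  height (F ∨f G) = suc (height F ⊔ height G)
  height (F ⇒f G) = suc (height F ⊔ height G)
  height (∀f x H) = suc (height H)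
  height (∃f x H) = suc (height H)

  -- evaluation with fuel (substituting parameters preserves height)
  evalN : Valuation → ℕ → Formula → Set
  evalN v _ (atom A) = T (v A)
  evalN v _ ⊥f = ⊥
  evalN v zero _ = ⊥
  evalN v (suc n) (F ∧f G) = evalN v n F × evalN v n G
  evalN v (suc n) (F ∨f G) = evalN v n F ⊎ evalN v n G
  evalN v (suc n) (F ⇒f G) = evalN v n F → evalN v n G
  evalN v (suc n) (∀f x H) = (a : Par) → evalN v n (substF x (par a) H)
  evalN v (suc n) (∃f x H) = Σ Par (λ a → evalN v n (substF x (par a) H))

  Sat : Valuation → Formula → Set
  Sat v F = evalN v (height F) F

  mutual
    ConstInT : Const → Term → Set
    ConstInT c (var y) = ⊥
    ConstInT c (par a) = ⊥
    ConstInT c (con d) = c ≡ d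
    ConstInT c (fun f ts) = ConstInTs c ts

    ConstInTs : ∀ {n} → Const → Vec Term n → Set
    ConstInTs c [] = ⊥
    ConstInTs c (s ∷ ss) = ConstInT c s ⊎ ConstInTs c ss

  mutual
    FunInT : Fun → Term → Set
    FunInT g (var y) = ⊥
    FunInT g (par a) = ⊥
    FunInT g (con d) = ⊥
    FunInT g (fun f ts) = (g ≡ f) ⊎ FunInTs g ts

    FunInTs : ∀ {n} → Fun → Vec Term n → Set
    FunInTs g [] = ⊥
    FunInTs g (s ∷ ss) = FunInT g s ⊎ FunInTs g ss

  ConstInA : Const → Atom → Set
  ConstInA c (rel p ts) = ConstInTs c ts
  ConstInA c (r ≐ s) = ConstInT c r ⊎ ConstInT c s

  FunInA : Fun → Atom → Set
  FunInA g (rel p ts) = FunInTs g ts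
  FunInA g (r ≐ s) = FunInT g r ⊎ FunInT g s

  RelInA : Rel → Atom → Set
  RelInA q (rel p ts) = q ≡ p
  RelInA q (r ≐ s) = ⊥

  OccInF : (Atom → Set) → Formula → Set
  OccInF P (atom A) = P A
  OccInF P ⊥f = ⊥
  OccInF P (F ∧f G) = OccInF P F ⊎ OccInF P G
  OccInF P (F ∨f G) = OccInF P F ⊎ OccInF P G
  OccInF P (F ⇒f G) = OccInF P F ⊎ OccInF P G
  OccInF P (∀f y H) = OccInF P H
  OccInF P (∃f y H) = OccInF P H

  record Lang : Set₁ where
    field
      inConst : Const → Set
      inFun   : Fun → Set
      inRel   : Rel → Set

  LangOf : List Formula → Lang
  LangOf Fs = record
    { inConst = λ c → Any (OccInF (ConstInA c)) Fs
    ; inFun   = λ f → Any (OccInF (FunInA f)) Fs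
    ; inRel   = λ p → Any (OccInF (RelInA p)) Fs
    }

  mutual
    TermIn : Lang → Term → Set
    TermIn L (var y) = ⊤
    TermIn L (par a) = ⊤
    TermIn L (con c) = Lang.inConst L c
    TermIn L (fun f ts) = Lang.inFun L f × TermsIn L ts

    TermsIn : ∀ {n} → Lang → Vec Term n → Set
    TermsIn L [] = ⊤
    TermsIn L (s ∷ ss) = TermIn L s × TermsIn L ss

  PureTermOf : Lang → Term → Set
  PureTermOf L t = PureT t × TermIn L t

  record EqValuation (L : Lang) (v : Valuation) : Set where
    field
      eq-refl  : ∀ t → PureTermOf L t → T (v (t ≐ t))
      eq-sym   : ∀ r s → PureTermOf L r → PureTermOf L s →
                 T (v (r ≐ s)) → T (v (s ≐ r))
      eq-trans : ∀ r s t → PureTermOf L r → PureTermOf L s → PureTermOf L t →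
                 T (v (r ≐ s)) → T (v (s ≐ t)) → T (v (r ≐ t))
      eq-fun   : ∀ f → Lang.inFun L f → (rs ss : Vec Term (funArity f)) →
                 VAll.All (PureTermOf L) rs → VAll.All (PureTermOf L) ss →
                 Pointwise (λ r s → T (v (r ≐ s))) rs ss →
                 T (v (fun f rs ≐ fun f ss))
      eq-rel   : ∀ p → Lang.inRel L p → (rs ss : Vec Term (relArity p)) →
                 VAll.All (PureTermOf L) rs → VAll.All (PureTermOf L) ss →
                 Pointwise (λ r s → T (v (r ≐ s))) rs ss →
                 T (v (rel p rs)) → T (v (rel p ss))

-- Soundness is proved for an environment semantics in which free variables are interpreted and
-- parameters may be renamed, so that the eigen-name conditions of ∀I and ∃E become coincidence
-- arguments.  It holds in every valuation in which = is a congruence for all symbols, and a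
-- valuation with equality for L(G₁,…,Gₘ,F) becomes one by collapsing the terms outside L to a
-- parameter, which changes no atom of L.
--
-- Completeness is by contraposition: if Gs ⊬ F then ¬F, Gs is consistent.  A chain of finite
-- consistent sets, each stage analysing every member of the previous one (with eventually every
-- parameter for ∀ and ¬∃, and with fresh ones for ∃ and ¬∀), has a Hintikka set as its union.
-- The valuation making true exactly the atoms derivable at all late enough stages satisfies the
-- union, and it is a valuation with equality because the equality axioms derive the congruence laws.
module Submission where

open import Defs
open import Level using (0ℓ)
open import Axiom.ExcludedMiddle using (ExcludedMiddle)
open import Data.List using (List; []; _∷_; _++_; map; foldr; deduplicateᵇ; upTo; cartesianProduct)
open import Data.List.Properties using (++-assoc)
open import Data.List.Relation.Binary.Subset.Propositional using (_⊆_)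
open import Data.List.Relation.Unary.All using (All)
import Data.List.Relation.Unary.All as All
open import Data.List.Relation.Unary.Any using (Any; here; there)
import Data.List.Relation.Unary.Any as Any
open import Data.List.Relation.Unary.Any.Properties using (map⁺)
open import Data.List.Membership.Propositional using (_∈_; lose)
open import Data.List.Membership.Propositional.Properties
  using (∈-++⁺ˡ; ∈-++⁺ʳ; ∈-map⁻; ∈-cartesianProduct⁺; ∈-cartesianProduct⁻; ∈-upTo⁺)
import Data.List.Membership.Setoid.Properties as SetoidMembership
open import Function using (_∘_; id)
open import Function.Bundles using (_⇔_; mk⇔; Equivalence)
open import Function.Construct.Identity using (⇔-id)
open import Function.Properties.Equivalence using () renaming (trans to ⇔-trans)
open import Function.Related.TypeIsomorphisms using (→-cong-⇔)
open import Data.Product.Function.NonDependent.Propositional using (_×-⇔_)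
open import Data.Sum.Function.Propositional using (_⊎-⇔_)
open import Data.Nat as ℕ using (ℕ; zero; suc; _≡ᵇ_; _⊔_; _≤_; s≤s; s≤s⁻¹; _≤′_; ≤′-reflexive; ≤′-step)
open import Data.Nat.Properties
  using (≡ᵇ⇒≡; ≡⇒≡ᵇ; m⊔n≤o⇒m≤o; m⊔n≤o⇒n≤o; ≤-refl; ≤-trans; m≤m⊔n; m≤n⊔m; m≤n⇒m≤n⊔o; m≤n⇒m≤o⊔n;
         1+n≰n; ≤⇒≤′)
open import Data.Bool using (Bool; true; false; T; if_then_else_)
open import Data.Vec using (Vec; []; _∷_)
import Data.Vec.Relation.Unary.All as VAll
open import Data.Vec.Relation.Binary.Pointwise.Inductive using (Pointwise; []; _∷_)
open import Data.Product using (Σ; _×_; _,_; proj₁; proj₂)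
import Data.Product as Prod
open import Data.Sum using (_⊎_; inj₁; inj₂)
import Data.Sum as Sum
open import Data.Empty using (⊥; ⊥-elim)
open import Data.Unit using (⊤; tt)
open import Relation.Nullary using (¬_; yes; no)
open import Relation.Nullary.Decidable using (⌊_⌋; toWitness; fromWitness)
open import Relation.Binary.PropositionalEquality
  using (_≡_; refl; sym; trans; cong; cong₂; subst; setoid; ≢-sym; module ≡-Reasoning)

open Equivalence using (to; from)

Π-⇔ : {I : Set} {P Q : I → Set} → (∀ i → P i ⇔ Q i) → ((i : I) → P i) ⇔ ((i : I) → Q i)
Π-⇔ e = mk⇔ (λ f i → to (e i) (f i)) (λ g i → from (e i) (g i))

Σ-⇔ : {I : Set} {P Q : I → Set} → (∀ i → P i ⇔ Q i) → Σ I P ⇔ Σ I Q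
Σ-⇔ e = mk⇔ (λ (i , p) → i , to (e i) p) (λ (i , q) → i , from (e i) q)

≡⇒⇔ : {A B : Set} → A ≡ B → A ⇔ B
≡⇒⇔ refl = ⇔-id _

∘inj₁ : {A : Set} {P Q R : A → Set} → (∀ x → P x ⊎ Q x → R x) → ∀ x → P x → R x
∘inj₁ h x = h x ∘ inj₁

∘inj₂ : {A : Set} {P Q R : A → Set} → (∀ x → P x ⊎ Q x → R x) → ∀ x → Q x → R x
∘inj₂ h x = h x ∘ inj₂

data ≡ᵇ-View (x y : ℕ) : Set where
  equal    : x ≡ y → (x ≡ᵇ y) ≡ true → ≡ᵇ-View x y
  distinct : ¬ x ≡ y → (x ≡ᵇ y) ≡ false → ≡ᵇ-View x y

≡ᵇ-view : ∀ x y → ≡ᵇ-View x y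
≡ᵇ-view x y with x ≡ᵇ y in e
... | true  = equal (≡ᵇ⇒≡ x y (subst T (sym e) tt)) e
... | false = distinct (λ p → subst T e (≡⇒≡ᵇ x y p)) e

≡ᵇ-refl : ∀ x → (x ≡ᵇ x) ≡ true
≡ᵇ-refl zero    = refl
≡ᵇ-refl (suc x) = ≡ᵇ-refl x

≢⇒≡ᵇ-false : ∀ {x y} → ¬ x ≡ y → (x ≡ᵇ y) ≡ false
≢⇒≡ᵇ-false {x} {y} x≢y with ≡ᵇ-view x y
... | equal x≡y _ = ⊥-elim (x≢y x≡y)
... | distinct _ e = e

_[_≔_] : (ℕ → ℕ) → ℕ → ℕ → ℕ → ℕ
(ρ [ x ≔ a ]) y = if x ≡ᵇ y then a else ρ y

update-same : ∀ ρ x a → (ρ [ x ≔ a ]) x ≡ a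
update-same ρ x a rewrite ≡ᵇ-refl x = refl

update-other : ∀ ρ x a y → ¬ x ≡ y → (ρ [ x ≔ a ]) y ≡ ρ y
update-other ρ x a y x≢y rewrite ≢⇒≡ᵇ-false x≢y = refl

update-swap : ∀ ρ x z a b w → ¬ x ≡ z → (ρ [ z ≔ a ] [ x ≔ b ]) w ≡ (ρ [ x ≔ b ] [ z ≔ a ]) w
update-swap ρ x z a b w x≢z with ≡ᵇ-view x w
... | equal refl e rewrite e | ≢⇒≡ᵇ-false (≢-sym x≢z) = refl
... | distinct _ e rewrite e = refl

⊔-boundˡ : ∀ {a b n} → suc (a ⊔ b) ≤ suc n → a ≤ n
⊔-boundˡ {a} {b} h = m⊔n≤o⇒m≤o a b (s≤s⁻¹ h)

⊔-boundʳ : ∀ {a b n} → suc (a ⊔ b) ≤ suc n → b ≤ n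
⊔-boundʳ {a} {b} h = m⊔n≤o⇒n≤o a b (s≤s⁻¹ h)

module Semantics (Sig : Signature) where
  open Syntax Sig

  Env : Set
  Env = ℕ → ℕ

  mutual
    instT : Env → Env → Term → Term
    instT π ρ (var y)    = par (ρ y)
    instT π ρ (par a)    = par (π a)
    instT π ρ (con c)    = con c
    instT π ρ (fun f ts) = fun f (instTs π ρ ts)

    instTs : ∀ {n} → Env → Env → Vec Term n → Vec Term n
    instTs π ρ []       = []
    instTs π ρ (t ∷ ts) = instT π ρ t ∷ instTs π ρ ts

  instA : Env → Env → Atom → Atom
  instA π ρ (rel p ts) = rel p (instTs π ρ ts)
  instA π ρ (r ≐ s)    = instT π ρ r ≐ instT π ρ s

  Holds : Valuation → Env → Env → Formula → Set
  Holds v π ρ (atom A) = T (v (instA π ρ A))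
  Holds v π ρ ⊥f       = ⊥
  Holds v π ρ (F ∧f G) = Holds v π ρ F × Holds v π ρ G
  Holds v π ρ (F ∨f G) = Holds v π ρ F ⊎ Holds v π ρ G
  Holds v π ρ (F ⇒f G) = Holds v π ρ F → Holds v π ρ G
  Holds v π ρ (∀f x H) = (a : ℕ) → Holds v π (ρ [ x ≔ a ]) H
  Holds v π ρ (∃f x H) = Σ ℕ (λ a → Holds v π (ρ [ x ≔ a ]) H)

  mutual
    instT-agree : ∀ t {π π' ρ ρ'} → (∀ x → VarInT x t → ρ x ≡ ρ' x) →
                  (∀ a → ParInT a t → π a ≡ π' a) → instT π ρ t ≡ instT π' ρ' t
    instT-agree (var y)    hv hp = cong par (hv y refl)
    instT-agree (par a)    hv hp = cong par (hp a refl)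
    instT-agree (con c)    hv hp = refl
    instT-agree (fun f ts) hv hp = cong (fun f) (instTs-agree ts hv hp)

    instTs-agree : ∀ {n} (ts : Vec Term n) {π π' ρ ρ'} → (∀ x → VarInTs x ts → ρ x ≡ ρ' x) →
                   (∀ a → ParInTs a ts → π a ≡ π' a) → instTs π ρ ts ≡ instTs π' ρ' ts
    instTs-agree []       hv hp = refl
    instTs-agree (t ∷ ts) hv hp =
      cong₂ _∷_ (instT-agree t (∘inj₁ hv) (∘inj₁ hp)) (instTs-agree ts (∘inj₂ hv) (∘inj₂ hp))

  instA-agree : ∀ A {π π' ρ ρ'} → (∀ x → VarInA x A → ρ x ≡ ρ' x) →
                (∀ a → ParInA a A → π a ≡ π' a) → instA π ρ A ≡ instA π' ρ' A
  instA-agree (rel p ts) hv hp = cong (rel p) (instTs-agree ts hv hp)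
  instA-agree (r ≐ s)    hv hp =
    cong₂ _≐_ (instT-agree r (∘inj₁ hv) (∘inj₁ hp)) (instT-agree s (∘inj₂ hv) (∘inj₂ hp))

  update-agree : ∀ {ρ ρ'} y a (H : Formula) → (∀ x → FreeF x (∀f y H) → ρ x ≡ ρ' x) →
                 ∀ x → FreeF x H → (ρ [ y ≔ a ]) x ≡ (ρ' [ y ≔ a ]) x
  update-agree y a H hv x o with ≡ᵇ-view y x
  ... | equal _ e rewrite e = refl
  ... | distinct y≢x e rewrite e = hv x (≢-sym y≢x , o)

  Holds-agree : ∀ v F {π π' ρ ρ'} → (∀ x → FreeF x F → ρ x ≡ ρ' x) →
                (∀ a → ParInF a F → π a ≡ π' a) → Holds v π ρ F ⇔ Holds v π' ρ' F
  Holds-agree v (atom A) hv hp = ≡⇒⇔ (cong (λ B → T (v B)) (instA-agree A hv hp))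
  Holds-agree v ⊥f       hv hp = ⇔-id _
  Holds-agree v (F ∧f G) hv hp =
    Holds-agree v F (∘inj₁ hv) (∘inj₁ hp) ×-⇔ Holds-agree v G (∘inj₂ hv) (∘inj₂ hp)
  Holds-agree v (F ∨f G) hv hp =
    Holds-agree v F (∘inj₁ hv) (∘inj₁ hp) ⊎-⇔ Holds-agree v G (∘inj₂ hv) (∘inj₂ hp)
  Holds-agree v (F ⇒f G) hv hp =
    →-cong-⇔ (Holds-agree v F (∘inj₁ hv) (∘inj₁ hp)) (Holds-agree v G (∘inj₂ hv) (∘inj₂ hp))
  Holds-agree v (∀f y H) hv hp = Π-⇔ (λ a → Holds-agree v H (update-agree y a H hv) hp)
  Holds-agree v (∃f y H) hv hp = Σ-⇔ (λ a → Holds-agree v H (update-agree y a H hv) hp)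

  nameVal : Env → Env → Name → ℕ
  nameVal π ρ (nvar z) = ρ z
  nameVal π ρ (npar a) = π a

  instT-name : ∀ π ρ y → instT π ρ (nameT y) ≡ par (nameVal π ρ y)
  instT-name π ρ (nvar z) = refl
  instT-name π ρ (npar a) = refl

  mutual
    instT-subst : ∀ t x y π ρ → instT π ρ (substT x (nameT y) t) ≡ instT π (ρ [ x ≔ nameVal π ρ y ]) t
    instT-subst (var z) x y π ρ with ≡ᵇ-view x z
    ... | equal _ e rewrite e = instT-name π ρ y
    ... | distinct _ e rewrite e = refl
    instT-subst (par a)    x y π ρ = refl
    instT-subst (con c)    x y π ρ = refl
    instT-subst (fun f ts) x y π ρ = cong (fun f) (instTs-subst ts x y π ρ)

    instTs-subst : ∀ {n} (ts : Vec Term n) x y π ρ →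
                   instTs π ρ (substTs x (nameT y) ts) ≡ instTs π (ρ [ x ≔ nameVal π ρ y ]) ts
    instTs-subst []       x y π ρ = refl
    instTs-subst (t ∷ ts) x y π ρ = cong₂ _∷_ (instT-subst t x y π ρ) (instTs-subst ts x y π ρ)

  instA-subst : ∀ A x y π ρ → instA π ρ (substA x (nameT y) A) ≡ instA π (ρ [ x ≔ nameVal π ρ y ]) A
  instA-subst (rel p ts) x y π ρ = cong (rel p) (instTs-subst ts x y π ρ)
  instA-subst (r ≐ s)    x y π ρ = cong₂ _≐_ (instT-subst r x y π ρ) (instT-subst s x y π ρ)

  nameVal-update : ∀ π ρ z a y → ¬ VarInT z (nameT y) → nameVal π (ρ [ z ≔ a ]) y ≡ nameVal π ρ y
  nameVal-update π ρ z a (nvar u) z≢u = update-other ρ z a u z≢u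
  nameVal-update π ρ z a (npar b) _   = refl

  update-under-binder : ∀ H x z y π ρ a → ¬ x ≡ z → (FreeF x H → ¬ VarInT z (nameT y)) →
                        ∀ w → FreeF w H →
                        (ρ [ z ≔ a ] [ x ≔ nameVal π (ρ [ z ≔ a ]) y ]) w ≡ (ρ [ x ≔ nameVal π ρ y ] [ z ≔ a ]) w
  update-under-binder H x z y π ρ a x≢z z∉y w o with w ℕ.≟ x
  ... | yes refl rewrite nameVal-update π ρ z a y (z∉y o) = update-swap ρ x z a _ x x≢z
  ... | no w≢x = begin
    (ρ [ z ≔ a ] [ x ≔ _ ]) w              ≡⟨ update-other (ρ [ z ≔ a ]) x _ w (≢-sym w≢x) ⟩
    (ρ [ z ≔ a ]) w                        ≡⟨ update-other (ρ [ z ≔ a ]) x _ w (≢-sym w≢x) ⟨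
    (ρ [ z ≔ a ] [ x ≔ nameVal π ρ y ]) w  ≡⟨ update-swap ρ x z a _ w x≢z ⟩
    (ρ [ x ≔ nameVal π ρ y ] [ z ≔ a ]) w  ∎
    where open ≡-Reasoning

  Holds-subst : ∀ v F x y π ρ → FreeFor (nameT y) x F →
                Holds v π ρ (substF x (nameT y) F) ⇔ Holds v π (ρ [ x ≔ nameVal π ρ y ]) F
  Holds-subst v (atom A) x y π ρ ff = ≡⇒⇔ (cong (λ B → T (v B)) (instA-subst A x y π ρ))
  Holds-subst v ⊥f       x y π ρ ff = ⇔-id _
  Holds-subst v (F ∧f G) x y π ρ (ffF , ffG) = Holds-subst v F x y π ρ ffF ×-⇔ Holds-subst v G x y π ρ ffG
  Holds-subst v (F ∨f G) x y π ρ (ffF , ffG) = Holds-subst v F x y π ρ ffF ⊎-⇔ Holds-subst v G x y π ρ ffG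
  Holds-subst v (F ⇒f G) x y π ρ (ffF , ffG) = →-cong-⇔ (Holds-subst v F x y π ρ ffF) (Holds-subst v G x y π ρ ffG)
  Holds-subst v (∀f z H) x y π ρ (z∉y , ffH) with ≡ᵇ-view x z
  ... | equal refl e rewrite e =
    Holds-agree v (∀f z H) (λ w o → sym (update-other ρ z _ w (≢-sym (proj₁ o)))) (λ _ _ → refl)
  ... | distinct x≢z e rewrite e = Π-⇔ λ a →
    ⇔-trans (Holds-subst v H x y π (ρ [ z ≔ a ]) ffH)
            (Holds-agree v H (update-under-binder H x z y π ρ a x≢z (λ o → z∉y (x≢z , o))) (λ _ _ → refl))
  Holds-subst v (∃f z H) x y π ρ (z∉y , ffH) with ≡ᵇ-view x z
  ... | equal refl e rewrite e =
    Holds-agree v (∃f z H) (λ w o → sym (update-other ρ z _ w (≢-sym (proj₁ o)))) (λ _ _ → refl)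
  ... | distinct x≢z e rewrite e = Σ-⇔ λ a →
    ⇔-trans (Holds-subst v H x y π (ρ [ z ≔ a ]) ffH)
            (Holds-agree v H (update-under-binder H x z y π ρ a x≢z (λ o → z∉y (x≢z , o))) (λ _ _ → refl))

  mutual
    substT-nonfree : ∀ x t u → ¬ VarInT x u → substT x t u ≡ u
    substT-nonfree x t (var z) x∉u with ≡ᵇ-view x z
    ... | equal x≡z _ = ⊥-elim (x∉u x≡z)
    ... | distinct _ e rewrite e = refl
    substT-nonfree x t (par a)    x∉u = refl
    substT-nonfree x t (con c)    x∉u = refl
    substT-nonfree x t (fun f ts) x∉u = cong (fun f) (substTs-nonfree x t ts x∉u)

    substTs-nonfree : ∀ {n} x t (us : Vec Term n) → ¬ VarInTs x us → substTs x t us ≡ us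
    substTs-nonfree x t []       x∉us = refl
    substTs-nonfree x t (u ∷ us) x∉us =
      cong₂ _∷_ (substT-nonfree x t u (x∉us ∘ inj₁)) (substTs-nonfree x t us (x∉us ∘ inj₂))

  substA-nonfree : ∀ x t A → ¬ VarInA x A → substA x t A ≡ A
  substA-nonfree x t (rel p ts) x∉A = cong (rel p) (substTs-nonfree x t ts x∉A)
  substA-nonfree x t (r ≐ s)    x∉A =
    cong₂ _≐_ (substT-nonfree x t r (x∉A ∘ inj₁)) (substT-nonfree x t s (x∉A ∘ inj₂))

  substF-nonfree : ∀ x t F → ¬ FreeF x F → substF x t F ≡ F
  substF-nonfree x t (atom A) x∉F = cong atom (substA-nonfree x t A x∉F)
  substF-nonfree x t ⊥f       x∉F = refl
  substF-nonfree x t (F ∧f G) x∉F = cong₂ _∧f_ (substF-nonfree x t F (x∉F ∘ inj₁)) (substF-nonfree x t G (x∉F ∘ inj₂))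
  substF-nonfree x t (F ∨f G) x∉F = cong₂ _∨f_ (substF-nonfree x t F (x∉F ∘ inj₁)) (substF-nonfree x t G (x∉F ∘ inj₂))
  substF-nonfree x t (F ⇒f G) x∉F = cong₂ _⇒f_ (substF-nonfree x t F (x∉F ∘ inj₁)) (substF-nonfree x t G (x∉F ∘ inj₂))
  substF-nonfree x t (∀f z H) x∉F with ≡ᵇ-view x z
  ... | equal _ e rewrite e = refl
  ... | distinct x≢z e rewrite e = cong (∀f z) (substF-nonfree x t H (λ o → x∉F (x≢z , o)))
  substF-nonfree x t (∃f z H) x∉F with ≡ᵇ-view x z
  ... | equal _ e rewrite e = refl
  ... | distinct x≢z e rewrite e = cong (∃f z) (substF-nonfree x t H (λ o → x∉F (x≢z , o)))

  par-freeFor : ∀ a x F → FreeFor (par a) x F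
  par-freeFor a x (atom A) = tt
  par-freeFor a x ⊥f       = tt
  par-freeFor a x (F ∧f G) = par-freeFor a x F , par-freeFor a x G
  par-freeFor a x (F ∨f G) = par-freeFor a x F , par-freeFor a x G
  par-freeFor a x (F ⇒f G) = par-freeFor a x F , par-freeFor a x G
  par-freeFor a x (∀f y H) = (λ _ ()) , par-freeFor a x H
  par-freeFor a x (∃f y H) = (λ _ ()) , par-freeFor a x H

  height-substF : ∀ x t F → height (substF x t F) ≡ height F
  height-substF x t (atom A) = refl
  height-substF x t ⊥f       = refl
  height-substF x t (F ∧f G) = cong₂ (λ a b → suc (a ⊔ b)) (height-substF x t F) (height-substF x t G)
  height-substF x t (F ∨f G) = cong₂ (λ a b → suc (a ⊔ b)) (height-substF x t F) (height-substF x t G)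
  height-substF x t (F ⇒f G) = cong₂ (λ a b → suc (a ⊔ b)) (height-substF x t F) (height-substF x t G)
  height-substF x t (∀f z H) with ≡ᵇ-view x z
  ... | equal _ e rewrite e = refl
  ... | distinct _ e rewrite e = cong suc (height-substF x t H)
  height-substF x t (∃f z H) with ≡ᵇ-view x z
  ... | equal _ e rewrite e = refl
  ... | distinct _ e rewrite e = cong suc (height-substF x t H)

  mutual
    VarInT-substT-par : ∀ w x a t → VarInT w (substT x (par a) t) → VarInT w t × ¬ w ≡ x
    VarInT-substT-par w x a (var z) o with ≡ᵇ-view x z
    ... | equal _ e rewrite e = ⊥-elim o
    ... | distinct x≢z e rewrite e = o , λ w≡x → x≢z (trans (sym w≡x) o)
    VarInT-substT-par w x a (fun f ts) o = VarInTs-substTs-par w x a ts o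

    VarInTs-substTs-par : ∀ {n} w x a (ts : Vec Term n) → VarInTs w (substTs x (par a) ts) → VarInTs w ts × ¬ w ≡ x
    VarInTs-substTs-par w x a (t ∷ ts) (inj₁ o) = Prod.map₁ inj₁ (VarInT-substT-par w x a t o)
    VarInTs-substTs-par w x a (t ∷ ts) (inj₂ o) = Prod.map₁ inj₂ (VarInTs-substTs-par w x a ts o)

  VarInA-substA-par : ∀ w x a A → VarInA w (substA x (par a) A) → VarInA w A × ¬ w ≡ x
  VarInA-substA-par w x a (rel p ts) o        = VarInTs-substTs-par w x a ts o
  VarInA-substA-par w x a (r ≐ s)    (inj₁ o) = Prod.map₁ inj₁ (VarInT-substT-par w x a r o)
  VarInA-substA-par w x a (r ≐ s)    (inj₂ o) = Prod.map₁ inj₂ (VarInT-substT-par w x a s o)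

  FreeF-substF-par : ∀ w x a F → FreeF w (substF x (par a) F) → FreeF w F × ¬ w ≡ x
  FreeF-substF-par w x a (atom A) o = VarInA-substA-par w x a A o
  FreeF-substF-par w x a (F ∧f G) (inj₁ o) = Prod.map₁ inj₁ (FreeF-substF-par w x a F o)
  FreeF-substF-par w x a (F ∧f G) (inj₂ o) = Prod.map₁ inj₂ (FreeF-substF-par w x a G o)
  FreeF-substF-par w x a (F ∨f G) (inj₁ o) = Prod.map₁ inj₁ (FreeF-substF-par w x a F o)
  FreeF-substF-par w x a (F ∨f G) (inj₂ o) = Prod.map₁ inj₂ (FreeF-substF-par w x a G o)
  FreeF-substF-par w x a (F ⇒f G) (inj₁ o) = Prod.map₁ inj₁ (FreeF-substF-par w x a F o)
  FreeF-substF-par w x a (F ⇒f G) (inj₂ o) = Prod.map₁ inj₂ (FreeF-substF-par w x a G o)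
  FreeF-substF-par w x a (∀f z H) o with ≡ᵇ-view x z
  ... | equal refl e rewrite e = o , proj₁ o
  ... | distinct _ e rewrite e = Prod.map₁ (proj₁ o ,_) (FreeF-substF-par w x a H (proj₂ o))
  FreeF-substF-par w x a (∃f z H) o with ≡ᵇ-view x z
  ... | equal refl e rewrite e = o , proj₁ o
  ... | distinct _ e rewrite e = Prod.map₁ (proj₁ o ,_) (FreeF-substF-par w x a H (proj₂ o))

  height-instance : ∀ x a H {n} → suc (height H) ≤ suc n → height (substF x (par a) H) ≤ n
  height-instance x a H {n} h = subst (_≤ n) (sym (height-substF x (par a) H)) (s≤s⁻¹ h)

  PureF-instance : ∀ x a H → (∀ w → ¬ w ≡ x → ¬ FreeF w H) → PureF (substF x (par a) H)
  PureF-instance x a H pure w o with FreeF-substF-par w x a H o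
  ... | o' , w≢x = pure w w≢x o'

  mutual
    instT-pure : ∀ ρ t → PureT t → instT id ρ t ≡ t
    instT-pure ρ (var y)    pure = ⊥-elim (pure y refl)
    instT-pure ρ (par a)    pure = refl
    instT-pure ρ (con c)    pure = refl
    instT-pure ρ (fun f ts) pure = cong (fun f) (instTs-pure ρ ts pure)

    instTs-pure : ∀ {n} ρ (ts : Vec Term n) → (∀ x → ¬ VarInTs x ts) → instTs id ρ ts ≡ ts
    instTs-pure ρ []       pure = refl
    instTs-pure ρ (t ∷ ts) pure =
      cong₂ _∷_ (instT-pure ρ t (∘inj₁ pure)) (instTs-pure ρ ts (∘inj₂ pure))

  instA-pure : ∀ ρ A → (∀ x → ¬ VarInA x A) → instA id ρ A ≡ A
  instA-pure ρ (rel p ts) pure = cong (rel p) (instTs-pure ρ ts pure)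
  instA-pure ρ (r ≐ s)    pure =
    cong₂ _≐_ (instT-pure ρ r (∘inj₁ pure)) (instT-pure ρ s (∘inj₂ pure))

  evalN⇔Holds : ∀ v n F → height F ≤ n → PureF F → ∀ ρ → evalN v n F ⇔ Holds v id ρ F
  evalN⇔Holds v n (atom A) _ pure ρ = ≡⇒⇔ (cong (λ B → T (v B)) (sym (instA-pure ρ A pure)))
  evalN⇔Holds v n ⊥f       _ pure ρ = ⇔-id _
  evalN⇔Holds v (suc n) (F ∧f G) h pure ρ =
    evalN⇔Holds v n F (⊔-boundˡ h) (∘inj₁ pure) ρ ×-⇔ evalN⇔Holds v n G (⊔-boundʳ h) (∘inj₂ pure) ρ
  evalN⇔Holds v (suc n) (F ∨f G) h pure ρ =
    evalN⇔Holds v n F (⊔-boundˡ h) (∘inj₁ pure) ρ ⊎-⇔ evalN⇔Holds v n G (⊔-boundʳ h) (∘inj₂ pure) ρ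
  evalN⇔Holds v (suc n) (F ⇒f G) h pure ρ =
    →-cong-⇔ (evalN⇔Holds v n F (⊔-boundˡ h) (∘inj₁ pure) ρ) (evalN⇔Holds v n G (⊔-boundʳ h) (∘inj₂ pure) ρ)
  evalN⇔Holds v (suc n) (∀f x H) h pure ρ = Π-⇔ λ a →
    ⇔-trans (evalN⇔Holds v n (substF x (par a) H) (height-instance x a H h) 
                          (PureF-instance x a H λ w ne o → pure w (ne , o)) ρ)
            (Holds-subst v H x (npar a) id ρ (par-freeFor a x H))
  evalN⇔Holds v (suc n) (∃f x H) h pure ρ = Σ-⇔ λ a →
    ⇔-trans (evalN⇔Holds v n (substF x (par a) H) (height-instance x a H h) 
                          (PureF-instance x a H λ w ne o → pure w (ne , o)) ρ)
            (Holds-subst v H x (npar a) id ρ (par-freeFor a x H))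

  Sat⇔Holds : ∀ v F → PureF F → ∀ ρ → Sat v F ⇔ Holds v id ρ F
  Sat⇔Holds v F pure = evalN⇔Holds v (height F) F ≤-refl pure

module Soundness (em : ExcludedMiddle 0ℓ) (Sig : Signature) where
  open Signature Sig
  open Syntax Sig
  open Semantics Sig

  record FullEqValuation (v : Valuation) : Set where
    field
      eq-refl  : ∀ t → PureT t → T (v (t ≐ t))
      eq-sym   : ∀ r s → PureT r → PureT s → T (v (r ≐ s)) → T (v (s ≐ r))
      eq-trans : ∀ r s t → PureT r → PureT s → PureT t →
                 T (v (r ≐ s)) → T (v (s ≐ t)) → T (v (r ≐ t))
      eq-fun   : ∀ f (rs ss : Vec Term (funArity f)) → VAll.All PureT rs → VAll.All PureT ss →
                 Pointwise (λ r s → T (v (r ≐ s))) rs ss → T (v (fun f rs ≐ fun f ss))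
      eq-rel   : ∀ p (rs ss : Vec Term (relArity p)) → VAll.All PureT rs → VAll.All PureT ss →
                 Pointwise (λ r s → T (v (r ≐ s))) rs ss → T (v (rel p rs)) → T (v (rel p ss))

  mutual
    instT-isPure : ∀ π ρ t → PureT (instT π ρ t)
    instT-isPure π ρ (fun f ts) x o = instTs-isPure π ρ ts x o

    instTs-isPure : ∀ {n} π ρ (ts : Vec Term n) → ∀ x → ¬ VarInTs x (instTs π ρ ts)
    instTs-isPure π ρ (t ∷ ts) x (inj₁ o) = instT-isPure π ρ t x o
    instTs-isPure π ρ (t ∷ ts) x (inj₂ o) = instTs-isPure π ρ ts x o

  instTs-allPure : ∀ {n} π ρ (ts : Vec Term n) → VAll.All PureT (instTs π ρ ts)
  instTs-allPure π ρ []       = VAll.[]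
  instTs-allPure π ρ (t ∷ ts) = instT-isPure π ρ t VAll.∷ instTs-allPure π ρ ts

  module Substitutivity (v : Valuation) (fullEq : FullEqValuation v) where
    open FullEqValuation fullEq

    _≈⟨_,_⟩_ : Term → Env → Env → Term → Set
    r ≈⟨ π , ρ ⟩ s = T (v (instT π ρ r ≐ instT π ρ s))

    ≈-sym : ∀ {π ρ} r s → r ≈⟨ π , ρ ⟩ s → s ≈⟨ π , ρ ⟩ r
    ≈-sym {π} {ρ} r s = eq-sym _ _ (instT-isPure π ρ r) (instT-isPure π ρ s)

    ≈-update : ∀ {π ρ} z a r s → ¬ VarInT z r → ¬ VarInT z s → r ≈⟨ π , ρ ⟩ s → r ≈⟨ π , ρ [ z ≔ a ] ⟩ s
    ≈-update {π} {ρ} z a r s z∉r z∉s =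
      subst (λ B → T (v B)) (cong₂ _≐_ (instT-agree r (unchanged {r} z∉r) (λ _ _ → refl))
                                       (instT-agree s (unchanged {s} z∉s) (λ _ _ → refl)))
      where
      unchanged : ∀ {t} → ¬ VarInT z t → ∀ w → VarInT w t → ρ w ≡ (ρ [ z ≔ a ]) w
      unchanged z∉t w o = sym (update-other ρ z a w λ { refl → z∉t o })

    mutual
      substT-cong : ∀ {π ρ} x r s t → r ≈⟨ π , ρ ⟩ s → substT x r t ≈⟨ π , ρ ⟩ substT x s t
      substT-cong x r s (var z) r≈s with ≡ᵇ-view x z
      ... | equal _ e rewrite e = r≈s
      ... | distinct _ e rewrite e = eq-refl _ (λ _ ())
      substT-cong x r s (par a) r≈s = eq-refl _ (λ _ ())
      substT-cong x r s (con c) r≈s = eq-refl _ (λ _ ())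
      substT-cong {π} {ρ} x r s (fun f ts) r≈s =
        eq-fun f _ _ (instTs-allPure π ρ _) (instTs-allPure π ρ _) (substTs-cong x r s ts r≈s)

      substTs-cong : ∀ {π ρ n} x r s (ts : Vec Term n) → r ≈⟨ π , ρ ⟩ s →
                     Pointwise (λ a b → T (v (a ≐ b))) (instTs π ρ (substTs x r ts)) (instTs π ρ (substTs x s ts))
      substTs-cong x r s []       r≈s = []
      substTs-cong x r s (t ∷ ts) r≈s = substT-cong x r s t r≈s ∷ substTs-cong x r s ts r≈s

    substA-cong : ∀ {π ρ} x r s A → r ≈⟨ π , ρ ⟩ s →
                  T (v (instA π ρ (substA x r A))) → T (v (instA π ρ (substA x s A)))
    substA-cong {π} {ρ} x r s (rel p ts) r≈s =
      eq-rel p _ _ (instTs-allPure π ρ _) (instTs-allPure π ρ _) (substTs-cong x r s ts r≈s)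
    substA-cong {π} {ρ} x r s (t₁ ≐ t₂) r≈s t₁≈t₂ =
      eq-trans _ _ _ (pure (substT x s t₁)) (pure (substT x r t₁)) (pure (substT x s t₂))
        (≈-sym (substT x r t₁) (substT x s t₁) (substT-cong x r s t₁ r≈s))
        (eq-trans _ _ _ (pure (substT x r t₁)) (pure (substT x r t₂)) (pure (substT x s t₂))
          t₁≈t₂ (substT-cong x r s t₂ r≈s))
      where
      pure : ∀ t → PureT (instT π ρ t)
      pure = instT-isPure π ρ

    Holds-subst-cong : ∀ F {π ρ} x r s → FreeFor r x F → FreeFor s x F → r ≈⟨ π , ρ ⟩ s →
                       Holds v π ρ (substF x r F) → Holds v π ρ (substF x s F)
    under-binder : ∀ H {π ρ x r s z} → ¬ x ≡ z →
                   (FreeF x (∀f z H) → ¬ VarInT z r) → (FreeF x (∀f z H) → ¬ VarInT z s) →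
                   FreeFor r x H → FreeFor s x H → r ≈⟨ π , ρ ⟩ s → ∀ a →
                   Holds v π (ρ [ z ≔ a ]) (substF x r H) → Holds v π (ρ [ z ≔ a ]) (substF x s H)

    Holds-subst-cong (atom A) x r s _ _ r≈s = substA-cong x r s A r≈s
    Holds-subst-cong ⊥f       x r s _ _ r≈s = id
    Holds-subst-cong (F ∧f G) x r s (frF , frG) (fsF , fsG) r≈s =
      Prod.map (Holds-subst-cong F x r s frF fsF r≈s) (Holds-subst-cong G x r s frG fsG r≈s)
    Holds-subst-cong (F ∨f G) x r s (frF , frG) (fsF , fsG) r≈s =
      Sum.map (Holds-subst-cong F x r s frF fsF r≈s) (Holds-subst-cong G x r s frG fsG r≈s)
    Holds-subst-cong (F ⇒f G) x r s (frF , frG) (fsF , fsG) r≈s h =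
      Holds-subst-cong G x r s frG fsG r≈s ∘ h ∘ Holds-subst-cong F x s r fsF frF (≈-sym r s r≈s)
    Holds-subst-cong (∀f z H) x r s (z∉r , frH) (z∉s , fsH) r≈s h with ≡ᵇ-view x z
    ... | equal _ e rewrite e = h
    ... | distinct x≢z e rewrite e = λ a → under-binder H x≢z z∉r z∉s frH fsH r≈s a (h a)
    Holds-subst-cong (∃f z H) x r s (z∉r , frH) (z∉s , fsH) r≈s h with ≡ᵇ-view x z
    ... | equal _ e rewrite e = h
    ... | distinct x≢z e rewrite e = Prod.map₂ (under-binder H x≢z z∉r z∉s frH fsH r≈s _) h

    under-binder H {x = x} {r} {s} {z} x≢z z∉r z∉s frH fsH r≈s a with em {FreeF x H}
    ... | yes x∈H = Holds-subst-cong H x r s frH fsH (≈-update z a r s (z∉r (x≢z , x∈H)) (z∉s (x≢z , x∈H)) r≈s)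
    ... | no x∉H rewrite substF-nonfree x r H x∉H | substF-nonfree x s H x∉H = id

  Holds-foldr-∀ : ∀ v π ρ G xs → (∀ ρ' → Holds v π ρ' G) → Holds v π ρ (foldr ∀f G xs)
  Holds-foldr-∀ v π ρ G []       h = h ρ
  Holds-foldr-∀ v π ρ G (x ∷ xs) h = λ a → Holds-foldr-∀ v π (ρ [ x ≔ a ]) G xs h

  Holds-closure : ∀ v π ρ G → (∀ ρ' → Holds v π ρ' G) → Holds v π ρ (closure G)
  Holds-closure v π ρ G = Holds-foldr-∀ v π ρ G (deduplicateᵇ _≡ᵇ_ (fvF G))

  EqAxiom-sound : ∀ {F} → EqAxiom F → ∀ v → FullEqValuation v → ∀ π ρ → Holds v π ρ F
  EqAxiom-sound (ax-refl t _) v fullEq π ρ =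
    Holds-closure v π ρ (atom (t ≐ t)) λ ρ' → FullEqValuation.eq-refl fullEq _ (instT-isPure π ρ' t)
  EqAxiom-sound (ax-subst r s x F _ _ _ frF fsF) v fullEq π ρ =
    Holds-closure v π ρ (atom (r ≐ s) ⇒f (substF x r F ⇒f substF x s F))
      λ ρ' → Substitutivity.Holds-subst-cong v fullEq F x r s frF fsF

  HoldsAll : Valuation → Env → Env → Ctx → Set
  HoldsAll v π ρ Γ = ∀ G → G ∈ Γ → Holds v π ρ G

  HoldsAll-∷ : ∀ {v π ρ Γ F} → Holds v π ρ F → HoldsAll v π ρ Γ → HoldsAll v π ρ (F ∷ Γ)
  HoldsAll-∷ h hs G (here refl) = h
  HoldsAll-∷ h hs G (there m)   = hs G m

  updateParam : Env → Name → ℕ → Env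
  updateParam π (nvar _) a = π
  updateParam π (npar b) a = π [ b ≔ a ]

  updateVar : Env → Name → ℕ → Env
  updateVar ρ (nvar z) a = ρ [ z ≔ a ]
  updateVar ρ (npar _) a = ρ

  Holds-fresh : ∀ v G π ρ y a → ¬ OccN y G → Holds v π ρ G ⇔ Holds v (updateParam π y a) (updateVar ρ y a) G
  Holds-fresh v G π ρ (nvar z) a z∉G =
    Holds-agree v G (λ w o → sym (update-other ρ z a w λ { refl → z∉G o })) (λ _ _ → refl)
  Holds-fresh v G π ρ (npar b) a b∉G =
    Holds-agree v G (λ _ _ → refl) (λ c o → sym (update-other π b a c λ { refl → b∉G o }))

  Holds-eigen : ∀ v F x π ρ y a → FreeFor (nameT y) x F → ¬ OccN y (∀f x F) →
                Holds v (updateParam π y a) (updateVar ρ y a) (substF x (nameT y) F) ⇔ Holds v π (ρ [ x ≔ a ]) F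
  Holds-eigen v F x π ρ y a ff y∉F =
    ⇔-trans (Holds-subst v F x y (updateParam π y a) (updateVar ρ y a) ff) (agree y y∉F)
    where
    agree : ∀ y → ¬ OccN y (∀f x F) →
            Holds v (updateParam π y a) (updateVar ρ y a [ x ≔ nameVal (updateParam π y a) (updateVar ρ y a) y ]) F
              ⇔ Holds v π (ρ [ x ≔ a ]) F
    agree (nvar z) z∉F = Holds-agree v F same (λ _ _ → refl)
      where
      same : ∀ w → FreeF w F → (ρ [ z ≔ a ] [ x ≔ (ρ [ z ≔ a ]) z ]) w ≡ (ρ [ x ≔ a ]) w
      same w o with ≡ᵇ-view x w
      ... | equal _ e rewrite e = update-same ρ z a
      ... | distinct x≢w e rewrite e = update-other ρ z a w λ { refl → z∉F (≢-sym x≢w , o) }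
    agree (npar b) b∉F =
      Holds-agree v F (λ w _ → cong (λ c → (ρ [ x ≔ c ]) w) (update-same π b a))
                      (λ c o → update-other π b a c λ { refl → b∉F o })

  OccN-∃⇒∀ : ∀ y {x F} → ¬ OccN y (∃f x F) → ¬ OccN y (∀f x F)
  OccN-∃⇒∀ (nvar z) = id
  OccN-∃⇒∀ (npar b) = id

  HoldsAll-fresh : ∀ {v π ρ Γ} y a → NotInCtx y Γ → HoldsAll v π ρ Γ →
                   HoldsAll v (updateParam π y a) (updateVar ρ y a) Γ
  HoldsAll-fresh {v} {π} {ρ} y a y∉Γ hs G m = to (Holds-fresh v G π ρ y a (y∉Γ G m)) (hs G m)

  ⊢-sound : ∀ {Γ F} → Γ ⊢ F → ∀ v → FullEqValuation v → ∀ π ρ → HoldsAll v π ρ Γ → Holds v π ρ F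
  ⊢-sound (hyp m)   v fe π ρ hs = hs _ m
  ⊢-sound (eqax ax) v fe π ρ hs = EqAxiom-sound ax v fe π ρ
  ⊢-sound (∧I d e)  v fe π ρ hs = ⊢-sound d v fe π ρ hs , ⊢-sound e v fe π ρ hs
  ⊢-sound (∧E₁ d)   v fe π ρ hs = proj₁ (⊢-sound d v fe π ρ hs)
  ⊢-sound (∧E₂ d)   v fe π ρ hs = proj₂ (⊢-sound d v fe π ρ hs)
  ⊢-sound (∨I₁ d)   v fe π ρ hs = inj₁ (⊢-sound d v fe π ρ hs)
  ⊢-sound (∨I₂ d)   v fe π ρ hs = inj₂ (⊢-sound d v fe π ρ hs)
  ⊢-sound (∨E d e₁ e₂) v fe π ρ hs with ⊢-sound d v fe π ρ hs
  ... | inj₁ h = ⊢-sound e₁ v fe π ρ (HoldsAll-∷ h hs)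
  ... | inj₂ h = ⊢-sound e₂ v fe π ρ (HoldsAll-∷ h hs)
  ⊢-sound (⇒I d)   v fe π ρ hs = λ h → ⊢-sound d v fe π ρ (HoldsAll-∷ h hs)
  ⊢-sound (⇒E d e) v fe π ρ hs = ⊢-sound d v fe π ρ hs (⊢-sound e v fe π ρ hs)
  ⊢-sound (raa {F = F} d) v fe π ρ hs with em {Holds v π ρ F}
  ... | yes h = h
  ... | no ¬h = ⊥-elim (⊢-sound d v fe π ρ (HoldsAll-∷ ¬h hs))
  ⊢-sound (∀I {x = x} {F = F} y ff y∉F y∉Γ d) v fe π ρ hs a =
    to (Holds-eigen v F x π ρ y a ff y∉F) (⊢-sound d v fe _ _ (HoldsAll-fresh y a y∉Γ hs))
  ⊢-sound (∀E {x = x} {F = F} y ff d) v fe π ρ hs =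
    from (Holds-subst v F x y π ρ ff) (⊢-sound d v fe π ρ hs (nameVal π ρ y))
  ⊢-sound (∃I {x = x} {F = F} y ff d) v fe π ρ hs =
    nameVal π ρ y , to (Holds-subst v F x y π ρ ff) (⊢-sound d v fe π ρ hs)
  ⊢-sound (∃E {x = x} {F = F} {G = G} y ff y∉F y∉G y∉Γ d e) v fe π ρ hs
    with ⊢-sound d v fe π ρ hs
  ... | a , h = from (Holds-fresh v G π ρ y a y∉G)
                  (⊢-sound e v fe _ _ (HoldsAll-∷ (from (Holds-eigen v F x π ρ y a ff (OccN-∃⇒∀ y y∉F)) h)
                                                  (HoldsAll-fresh y a y∉Γ hs)))

  AtomIn : Lang → Atom → Set
  AtomIn L (rel p ts) = Lang.inRel L p × TermsIn L ts
  AtomIn L (r ≐ s)    = TermIn L r × TermIn L s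

  FormulaIn : Lang → Formula → Set
  FormulaIn L (atom A) = AtomIn L A
  FormulaIn L ⊥f       = ⊤
  FormulaIn L (F ∧f G) = FormulaIn L F × FormulaIn L G
  FormulaIn L (F ∨f G) = FormulaIn L F × FormulaIn L G
  FormulaIn L (F ⇒f G) = FormulaIn L F × FormulaIn L G
  FormulaIn L (∀f x H) = FormulaIn L H
  FormulaIn L (∃f x H) = FormulaIn L H

  module _ (L : Lang) where
    open Lang L

    mutual
      symbols⇒TermIn : ∀ t → (∀ c → ConstInT c t → inConst c) → (∀ f → FunInT f t → inFun f) → TermIn L t
      symbols⇒TermIn (var y)    hc hf = tt
      symbols⇒TermIn (par a)    hc hf = tt
      symbols⇒TermIn (con c)    hc hf = hc c refl
      symbols⇒TermIn (fun f ts) hc hf = hf f (inj₁ refl) , symbols⇒TermsIn ts hc (∘inj₂ hf)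

      symbols⇒TermsIn : ∀ {n} (ts : Vec Term n) → (∀ c → ConstInTs c ts → inConst c) →
                        (∀ f → FunInTs f ts → inFun f) → TermsIn L ts
      symbols⇒TermsIn []       hc hf = tt
      symbols⇒TermsIn (t ∷ ts) hc hf =
        symbols⇒TermIn t (∘inj₁ hc) (∘inj₁ hf) , symbols⇒TermsIn ts (∘inj₂ hc) (∘inj₂ hf)

    symbols⇒FormulaIn : ∀ F → (∀ c → OccInF (ConstInA c) F → inConst c) → (∀ f → OccInF (FunInA f) F → inFun f) →
                        (∀ p → OccInF (RelInA p) F → inRel p) → FormulaIn L F
    symbols⇒FormulaIn (atom (rel p ts)) hc hf hr = hr p refl , symbols⇒TermsIn ts hc hf
    symbols⇒FormulaIn (atom (r ≐ s))    hc hf hr =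
      symbols⇒TermIn r (∘inj₁ hc) (∘inj₁ hf) , symbols⇒TermIn s (∘inj₂ hc) (∘inj₂ hf)
    symbols⇒FormulaIn ⊥f       hc hf hr = tt
    symbols⇒FormulaIn (F ∧f G) hc hf hr =
      symbols⇒FormulaIn F (∘inj₁ hc) (∘inj₁ hf) (∘inj₁ hr) ,
      symbols⇒FormulaIn G (∘inj₂ hc) (∘inj₂ hf) (∘inj₂ hr)
    symbols⇒FormulaIn (F ∨f G) hc hf hr =
      symbols⇒FormulaIn F (∘inj₁ hc) (∘inj₁ hf) (∘inj₁ hr) ,
      symbols⇒FormulaIn G (∘inj₂ hc) (∘inj₂ hf) (∘inj₂ hr)
    symbols⇒FormulaIn (F ⇒f G) hc hf hr =
      symbols⇒FormulaIn F (∘inj₁ hc) (∘inj₁ hf) (∘inj₁ hr) ,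
      symbols⇒FormulaIn G (∘inj₂ hc) (∘inj₂ hf) (∘inj₂ hr)
    symbols⇒FormulaIn (∀f x H) = symbols⇒FormulaIn H
    symbols⇒FormulaIn (∃f x H) = symbols⇒FormulaIn H

    mutual
      instT-TermIn : ∀ π ρ t → TermIn L t → TermIn L (instT π ρ t)
      instT-TermIn π ρ (var y)    _        = tt
      instT-TermIn π ρ (par a)    _        = tt
      instT-TermIn π ρ (con c)    c∈L      = c∈L
      instT-TermIn π ρ (fun f ts) (f∈L , ts∈L) = f∈L , instTs-TermsIn π ρ ts ts∈L

      instTs-TermsIn : ∀ {n} π ρ (ts : Vec Term n) → TermsIn L ts → TermsIn L (instTs π ρ ts)
      instTs-TermsIn π ρ []       _              = tt
      instTs-TermsIn π ρ (t ∷ ts) (t∈L , ts∈L) = instT-TermIn π ρ t t∈L , instTs-TermsIn π ρ ts ts∈L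

    instA-AtomIn : ∀ π ρ A → AtomIn L A → AtomIn L (instA π ρ A)
    instA-AtomIn π ρ (rel p ts) (p∈L , ts∈L) = p∈L , instTs-TermsIn π ρ ts ts∈L
    instA-AtomIn π ρ (r ≐ s)    (r∈L , s∈L)  = instT-TermIn π ρ r r∈L , instT-TermIn π ρ s s∈L

  LangOf-FormulaIn : ∀ {Fs G} → G ∈ Fs → FormulaIn (LangOf Fs) G
  LangOf-FormulaIn {Fs} {G} m = symbols⇒FormulaIn (LangOf Fs) G (λ _ → lose m) (λ _ → lose m) (λ _ → lose m)

  -- A symbol outside L applied to anything yields the parameter 0, so = stays a congruence for it.
  module Extension (L : Lang) (v : Valuation) (eqv : EqValuation L v) where
    open Lang L
    open EqValuation eqv

    mutual
      collapseT : Term → Term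
      collapseT (var y) = var y
      collapseT (par a) = par a
      collapseT (con c) with em {inConst c}
      ... | yes _ = con c
      ... | no _  = par 0
      collapseT (fun f ts) with em {inFun f}
      ... | yes _ = fun f (collapseTs ts)
      ... | no _  = par 0

      collapseTs : ∀ {n} → Vec Term n → Vec Term n
      collapseTs []       = []
      collapseTs (t ∷ ts) = collapseT t ∷ collapseTs ts

    mutual
      collapseT-pure : ∀ t → PureT t → PureTermOf L (collapseT t)
      collapseT-pure (var y) pure = ⊥-elim (pure y refl)
      collapseT-pure (par a) pure = (λ _ ()) , tt
      collapseT-pure (con c) pure with em {inConst c}
      ... | yes c∈L = (λ _ ()) , c∈L
      ... | no _    = (λ _ ()) , tt
      collapseT-pure (fun f ts) pure with em {inFun f}
      ... | yes f∈L = Prod.map id (f∈L ,_) (collapseTs-pure ts pure)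
      ... | no _    = (λ _ ()) , tt

      collapseTs-pure : ∀ {n} (ts : Vec Term n) → (∀ x → ¬ VarInTs x ts) →
                        (∀ x → ¬ VarInTs x (collapseTs ts)) × TermsIn L (collapseTs ts)
      collapseTs-pure []       pure = (λ _ ()) , tt
      collapseTs-pure (t ∷ ts) pure with collapseT-pure t (∘inj₁ pure) | collapseTs-pure ts (∘inj₂ pure)
      ... | (t-pure , t∈L) | (ts-pure , ts∈L) = (λ x → Sum.[ t-pure x , ts-pure x ]) , t∈L , ts∈L

    collapseTs-allPure : ∀ {n} (ts : Vec Term n) → VAll.All PureT ts → VAll.All (PureTermOf L) (collapseTs ts)
    collapseTs-allPure []       VAll.[]         = VAll.[]
    collapseTs-allPure (t ∷ ts) (p VAll.∷ ps) = collapseT-pure t p VAll.∷ collapseTs-allPure ts ps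

    mutual
      collapseT-TermIn : ∀ t → TermIn L t → collapseT t ≡ t
      collapseT-TermIn (var y) _ = refl
      collapseT-TermIn (par a) _ = refl
      collapseT-TermIn (con c) c∈L with em {inConst c}
      ... | yes _  = refl
      ... | no c∉L = ⊥-elim (c∉L c∈L)
      collapseT-TermIn (fun f ts) (f∈L , ts∈L) with em {inFun f}
      ... | yes _  = cong (fun f) (collapseTs-TermsIn ts ts∈L)
      ... | no f∉L = ⊥-elim (f∉L f∈L)

      collapseTs-TermsIn : ∀ {n} (ts : Vec Term n) → TermsIn L ts → collapseTs ts ≡ ts
      collapseTs-TermsIn []       _              = refl
      collapseTs-TermsIn (t ∷ ts) (t∈L , ts∈L) = cong₂ _∷_ (collapseT-TermIn t t∈L) (collapseTs-TermsIn ts ts∈L)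

    extended : Valuation
    extended (r ≐ s) = v (collapseT r ≐ collapseT s)
    extended (rel p ts) with em {inRel p}
    ... | yes _ = v (rel p (collapseTs ts))
    ... | no _  = false

    collapse-pointwise : ∀ {n} (rs ss : Vec Term n) → Pointwise (λ r s → T (extended (r ≐ s))) rs ss →
                         Pointwise (λ r s → T (v (r ≐ s))) (collapseTs rs) (collapseTs ss)
    collapse-pointwise []       []       []       = []
    collapse-pointwise (r ∷ rs) (s ∷ ss) (e ∷ es) = e ∷ collapse-pointwise rs ss es

    extended-fullEq : FullEqValuation extended
    extended-fullEq = record
      { eq-refl  = λ t pt → eq-refl (collapseT t) (collapseT-pure t pt)
      ; eq-sym   = λ r s pr ps → eq-sym (collapseT r) (collapseT s) (collapseT-pure r pr) (collapseT-pure s ps)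
      ; eq-trans = λ r s t pr ps pt →
          eq-trans (collapseT r) (collapseT s) (collapseT t) (collapseT-pure r pr) (collapseT-pure s ps) (collapseT-pure t pt)
      ; eq-fun   = fun-cong
      ; eq-rel   = rel-cong
      }
      where
      fun-cong : ∀ f (rs ss : Vec Term (funArity f)) → VAll.All PureT rs → VAll.All PureT ss →
                 Pointwise (λ r s → T (extended (r ≐ s))) rs ss → T (extended (fun f rs ≐ fun f ss))
      fun-cong f rs ss prs pss es with em {inFun f}
      ... | yes f∈L = eq-fun f f∈L _ _ (collapseTs-allPure rs prs) (collapseTs-allPure ss pss) (collapse-pointwise rs ss es)
      ... | no _    = eq-refl (par 0) ((λ _ ()) , tt)
      rel-cong : ∀ p (rs ss : Vec Term (relArity p)) → VAll.All PureT rs → VAll.All PureT ss →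
                 Pointwise (λ r s → T (extended (r ≐ s))) rs ss → T (extended (rel p rs)) → T (extended (rel p ss))
      rel-cong p rs ss prs pss es with em {inRel p}
      ... | yes p∈L = eq-rel p p∈L _ _ (collapseTs-allPure rs prs) (collapseTs-allPure ss pss) (collapse-pointwise rs ss es)
      ... | no _    = id

    extended-AtomIn : ∀ A → AtomIn L A → extended A ≡ v A
    extended-AtomIn (rel p ts) (p∈L , ts∈L) with em {inRel p}
    ... | yes _  = cong (λ us → v (rel p us)) (collapseTs-TermsIn ts ts∈L)
    ... | no p∉L = ⊥-elim (p∉L p∈L)
    extended-AtomIn (r ≐ s) (r∈L , s∈L) = cong₂ (λ a b → v (a ≐ b)) (collapseT-TermIn r r∈L) (collapseT-TermIn s s∈L)

    Holds-extended : ∀ F → FormulaIn L F → ∀ π ρ → Holds extended π ρ F ⇔ Holds v π ρ F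
    Holds-extended (atom A) A∈L π ρ = ≡⇒⇔ (cong T (extended-AtomIn (instA π ρ A) (instA-AtomIn L π ρ A A∈L)))
    Holds-extended ⊥f       _ π ρ = ⇔-id _
    Holds-extended (F ∧f G) (F∈L , G∈L) π ρ = Holds-extended F F∈L π ρ ×-⇔ Holds-extended G G∈L π ρ
    Holds-extended (F ∨f G) (F∈L , G∈L) π ρ = Holds-extended F F∈L π ρ ⊎-⇔ Holds-extended G G∈L π ρ
    Holds-extended (F ⇒f G) (F∈L , G∈L) π ρ = →-cong-⇔ (Holds-extended F F∈L π ρ) (Holds-extended G G∈L π ρ)
    Holds-extended (∀f x H) H∈L π ρ = Π-⇔ λ a → Holds-extended H H∈L π (ρ [ x ≔ a ])
    Holds-extended (∃f x H) H∈L π ρ = Σ-⇔ λ a → Holds-extended H H∈L π (ρ [ x ≔ a ])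

  soundness : ∀ Gs F → All PureF Gs → PureF F → Gs ⊢ F →
              (v : Valuation) → EqValuation (LangOf (F ∷ Gs)) v → All (Sat v) Gs → Sat v F
  soundness Gs F pureGs pureF d v eqv satGs =
    from (Sat⇔Holds v F pureF ρ₀)
      (to (Holds-extended F (LangOf-FormulaIn {F ∷ Gs} (here refl)) id ρ₀)
        (⊢-sound d extended extended-fullEq id ρ₀ λ G m →
          from (Holds-extended G (LangOf-FormulaIn (there m)) id ρ₀)
            (to (Sat⇔Holds v G (All.lookup pureGs m) ρ₀) (All.lookup satGs m))))
    where
    open Extension (LangOf (F ∷ Gs)) v eqv
    ρ₀ : Env
    ρ₀ _ = 0

module Completeness (em : ExcludedMiddle 0ℓ) (Sig : Signature) where
  open Signature Sig
  open Syntax Sig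
  open Semantics Sig

  elemᵇ : ℕ → List ℕ → Bool
  elemᵇ x []       = false
  elemᵇ x (y ∷ ys) = if x ≡ᵇ y then true else elemᵇ x ys

  -- ∀-eliminate the prefix xs with the parameters σ x; a variable repeated later in xs is
  -- still bound, so it is only instantiated at its last occurrence.
  instantiatePrefix : (ℕ → ℕ) → List ℕ → Formula → Formula
  instantiatePrefix σ []       G = G
  instantiatePrefix σ (x ∷ xs) G = instantiatePrefix σ xs (if elemᵇ x xs then G else substF x (par (σ x)) G)

  substF-foldr-∀ : ∀ x t G xs → substF x t (foldr ∀f G xs) ≡ foldr ∀f (if elemᵇ x xs then G else substF x t G) xs
  substF-foldr-∀ x t G []       = refl
  substF-foldr-∀ x t G (y ∷ ys) with ≡ᵇ-view x y
  ... | equal _ e rewrite e = refl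
  ... | distinct _ e rewrite e = cong (∀f y) (substF-foldr-∀ x t G ys)

  ⊢-instantiatePrefix : ∀ {Γ} σ xs G → Γ ⊢ foldr ∀f G xs → Γ ⊢ instantiatePrefix σ xs G
  ⊢-instantiatePrefix σ []       G d = d
  ⊢-instantiatePrefix σ (x ∷ xs) G d =
    ⊢-instantiatePrefix σ xs _
      (subst (_ ⊢_) (substF-foldr-∀ x (par (σ x)) G xs) (∀E (npar (σ x)) (par-freeFor (σ x) x (foldr ∀f G xs)) d))

  QuantifierFree : Formula → Set
  QuantifierFree (atom A) = ⊤
  QuantifierFree ⊥f       = ⊤
  QuantifierFree (F ∧f G) = QuantifierFree F × QuantifierFree G
  QuantifierFree (F ∨f G) = QuantifierFree F × QuantifierFree G
  QuantifierFree (F ⇒f G) = QuantifierFree F × QuantifierFree G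
  QuantifierFree (∀f x H) = ⊥
  QuantifierFree (∃f x H) = ⊥

  mutual
    groundT : (ℕ → ℕ) → Term → Term
    groundT σ (var y)    = par (σ y)
    groundT σ (par a)    = par a
    groundT σ (con c)    = con c
    groundT σ (fun f ts) = fun f (groundTs σ ts)

    groundTs : ∀ {n} → (ℕ → ℕ) → Vec Term n → Vec Term n
    groundTs σ []       = []
    groundTs σ (t ∷ ts) = groundT σ t ∷ groundTs σ ts

  groundA : (ℕ → ℕ) → Atom → Atom
  groundA σ (rel p ts) = rel p (groundTs σ ts)
  groundA σ (r ≐ s)    = groundT σ r ≐ groundT σ s

  groundF : (ℕ → ℕ) → Formula → Formula
  groundF σ (atom A) = atom (groundA σ A)
  groundF σ ⊥f       = ⊥f
  groundF σ (F ∧f G) = groundF σ F ∧f groundF σ G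
  groundF σ (F ∨f G) = groundF σ F ∨f groundF σ G
  groundF σ (F ⇒f G) = groundF σ F ⇒f groundF σ G
  groundF σ (∀f x H) = ∀f x H
  groundF σ (∃f x H) = ∃f x H

  mutual
    groundT-pure : ∀ σ t → PureT t → groundT σ t ≡ t
    groundT-pure σ (var y)    pure = ⊥-elim (pure y refl)
    groundT-pure σ (par a)    pure = refl
    groundT-pure σ (con c)    pure = refl
    groundT-pure σ (fun f ts) pure = cong (fun f) (groundTs-pure σ ts pure)

    groundTs-pure : ∀ {n} σ (ts : Vec Term n) → (∀ z → ¬ VarInTs z ts) → groundTs σ ts ≡ ts
    groundTs-pure σ []       pure = refl
    groundTs-pure σ (t ∷ ts) pure =
      cong₂ _∷_ (groundT-pure σ t (∘inj₁ pure)) (groundTs-pure σ ts (∘inj₂ pure))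

  groundA-pure : ∀ σ A → (∀ z → ¬ VarInA z A) → groundA σ A ≡ A
  groundA-pure σ (rel p ts) pure = cong (rel p) (groundTs-pure σ ts pure)
  groundA-pure σ (r ≐ s)    pure =
    cong₂ _≐_ (groundT-pure σ r (∘inj₁ pure)) (groundT-pure σ s (∘inj₂ pure))

  groundF-pure : ∀ σ G → QuantifierFree G → PureF G → groundF σ G ≡ G
  groundF-pure σ (atom A) _ pure = cong atom (groundA-pure σ A pure)
  groundF-pure σ ⊥f       _ pure = refl
  groundF-pure σ (F ∧f G) (qF , qG) pure =
    cong₂ _∧f_ (groundF-pure σ F qF (∘inj₁ pure)) (groundF-pure σ G qG (∘inj₂ pure))
  groundF-pure σ (F ∨f G) (qF , qG) pure =
    cong₂ _∨f_ (groundF-pure σ F qF (∘inj₁ pure)) (groundF-pure σ G qG (∘inj₂ pure))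
  groundF-pure σ (F ⇒f G) (qF , qG) pure =
    cong₂ _⇒f_ (groundF-pure σ F qF (∘inj₁ pure)) (groundF-pure σ G qG (∘inj₂ pure))

  mutual
    groundT-substT : ∀ σ x t → groundT σ (substT x (par (σ x)) t) ≡ groundT σ t
    groundT-substT σ x (var z) with ≡ᵇ-view x z
    ... | equal refl e rewrite e = refl
    ... | distinct _ e rewrite e = refl
    groundT-substT σ x (par a)    = refl
    groundT-substT σ x (con c)    = refl
    groundT-substT σ x (fun f ts) = cong (fun f) (groundTs-substTs σ x ts)

    groundTs-substTs : ∀ {n} σ x (ts : Vec Term n) → groundTs σ (substTs x (par (σ x)) ts) ≡ groundTs σ ts
    groundTs-substTs σ x []       = refl
    groundTs-substTs σ x (t ∷ ts) = cong₂ _∷_ (groundT-substT σ x t) (groundTs-substTs σ x ts)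

  groundA-substA : ∀ σ x A → groundA σ (substA x (par (σ x)) A) ≡ groundA σ A
  groundA-substA σ x (rel p ts) = cong (rel p) (groundTs-substTs σ x ts)
  groundA-substA σ x (r ≐ s)    = cong₂ _≐_ (groundT-substT σ x r) (groundT-substT σ x s)

  groundF-substF : ∀ σ x G → QuantifierFree G → groundF σ (substF x (par (σ x)) G) ≡ groundF σ G
  groundF-substF σ x (atom A) _         = cong atom (groundA-substA σ x A)
  groundF-substF σ x ⊥f       _         = refl
  groundF-substF σ x (F ∧f G) (qF , qG) = cong₂ _∧f_ (groundF-substF σ x F qF) (groundF-substF σ x G qG)
  groundF-substF σ x (F ∨f G) (qF , qG) = cong₂ _∨f_ (groundF-substF σ x F qF) (groundF-substF σ x G qG)
  groundF-substF σ x (F ⇒f G) (qF , qG) = cong₂ _⇒f_ (groundF-substF σ x F qF) (groundF-substF σ x G qG)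

  QuantifierFree-substF : ∀ x t G → QuantifierFree G → QuantifierFree (substF x t G)
  QuantifierFree-substF x t (atom A) _         = tt
  QuantifierFree-substF x t ⊥f       _         = tt
  QuantifierFree-substF x t (F ∧f G) (qF , qG) = QuantifierFree-substF x t F qF , QuantifierFree-substF x t G qG
  QuantifierFree-substF x t (F ∨f G) (qF , qG) = QuantifierFree-substF x t F qF , QuantifierFree-substF x t G qG
  QuantifierFree-substF x t (F ⇒f G) (qF , qG) = QuantifierFree-substF x t F qF , QuantifierFree-substF x t G qG

  instantiatePrefix≡groundF : ∀ σ xs G → QuantifierFree G → (∀ z → FreeF z G → T (elemᵇ z xs)) →
                              instantiatePrefix σ xs G ≡ groundF σ G
  instantiatePrefix≡groundF σ [] G qG fv⊆xs = sym (groundF-pure σ G qG fv⊆xs)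
  instantiatePrefix≡groundF σ (x ∷ xs) G qG fv⊆xs with elemᵇ x xs in x∈xs
  ... | true  = instantiatePrefix≡groundF σ xs G qG fv⊆xs'
    where
    fv⊆xs' : ∀ z → FreeF z G → T (elemᵇ z xs)
    fv⊆xs' z o with ≡ᵇ-view z x | fv⊆xs z o
    ... | equal refl _   | _ rewrite x∈xs = tt
    ... | distinct _ e   | z∈ rewrite e = z∈
  ... | false = trans (instantiatePrefix≡groundF σ xs _ (QuantifierFree-substF x _ G qG) fv⊆xs')
                      (groundF-substF σ x G qG)
    where
    fv⊆xs' : ∀ z → FreeF z (substF x (par (σ x)) G) → T (elemᵇ z xs)
    fv⊆xs' z o with FreeF-substF-par z x (σ x) G o
    ... | o' , z≢x with fv⊆xs z o'
    ... | z∈ rewrite ≢⇒≡ᵇ-false z≢x = z∈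

  mutual
    VarInT⇒∈fvT : ∀ z t → VarInT z t → z ∈ fvT t
    VarInT⇒∈fvT z (var y)    refl = here refl
    VarInT⇒∈fvT z (fun f ts) o    = VarInTs⇒∈fvTs z ts o

    VarInTs⇒∈fvTs : ∀ {n} z (ts : Vec Term n) → VarInTs z ts → z ∈ fvTs ts
    VarInTs⇒∈fvTs z (t ∷ ts) (inj₁ o) = ∈-++⁺ˡ (VarInT⇒∈fvT z t o)
    VarInTs⇒∈fvTs z (t ∷ ts) (inj₂ o) = ∈-++⁺ʳ (fvT t) (VarInTs⇒∈fvTs z ts o)

  FreeF⇒∈fvF : ∀ z G → QuantifierFree G → FreeF z G → z ∈ fvF G
  FreeF⇒∈fvF z (atom (rel p ts)) _ o        = VarInTs⇒∈fvTs z ts o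
  FreeF⇒∈fvF z (atom (r ≐ s))    _ (inj₁ o) = ∈-++⁺ˡ (VarInT⇒∈fvT z r o)
  FreeF⇒∈fvF z (atom (r ≐ s))    _ (inj₂ o) = ∈-++⁺ʳ (fvT r) (VarInT⇒∈fvT z s o)
  FreeF⇒∈fvF z (F ∧f G) (qF , _)  (inj₁ o) = ∈-++⁺ˡ (FreeF⇒∈fvF z F qF o)
  FreeF⇒∈fvF z (F ∧f G) (_ , qG)  (inj₂ o) = ∈-++⁺ʳ (fvF F) (FreeF⇒∈fvF z G qG o)
  FreeF⇒∈fvF z (F ∨f G) (qF , _)  (inj₁ o) = ∈-++⁺ˡ (FreeF⇒∈fvF z F qF o)
  FreeF⇒∈fvF z (F ∨f G) (_ , qG)  (inj₂ o) = ∈-++⁺ʳ (fvF F) (FreeF⇒∈fvF z G qG o)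
  FreeF⇒∈fvF z (F ⇒f G) (qF , _)  (inj₁ o) = ∈-++⁺ˡ (FreeF⇒∈fvF z F qF o)
  FreeF⇒∈fvF z (F ⇒f G) (_ , qG)  (inj₂ o) = ∈-++⁺ʳ (fvF F) (FreeF⇒∈fvF z G qG o)

  ∈⇒elemᵇ : ∀ z ys → z ∈ ys → T (elemᵇ z ys)
  ∈⇒elemᵇ z (y ∷ ys) (here refl) rewrite ≡ᵇ-refl z = tt
  ∈⇒elemᵇ z (y ∷ ys) (there m) with z ≡ᵇ y
  ... | true  = tt
  ... | false = ∈⇒elemᵇ z ys m

  ∈-deduplicateᵇ : ∀ {z xs} → z ∈ xs → z ∈ deduplicateᵇ _≡ᵇ_ xs
  ∈-deduplicateᵇ = SetoidMembership.∈-deduplicate⁺ (setoid ℕ) _ (λ {_} {y} {z} y≡ᵇz x≡y → trans x≡y (sym (≡ᵇ⇒≡ z y y≡ᵇz)))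

  ⊢-closure-elim : ∀ {Γ} σ G → QuantifierFree G → Γ ⊢ closure G → Γ ⊢ groundF σ G
  ⊢-closure-elim σ G qG d =
    subst (_ ⊢_) (instantiatePrefix≡groundF σ xs G qG λ z o → ∈⇒elemᵇ z xs (∈-deduplicateᵇ (FreeF⇒∈fvF z G qG o)))
          (⊢-instantiatePrefix σ xs G d)
    where xs = deduplicateᵇ _≡ᵇ_ (fvF G)

  -- The equality axioms are parameter-free; their pure instances are reached by turning each
  -- parameter a into the variable suc a and instantiating the closure back with pred.
  mutual
    abstractT : Term → Term
    abstractT (var y)    = var y
    abstractT (par a)    = var (suc a)
    abstractT (con c)    = con c
    abstractT (fun f ts) = fun f (abstractTs ts)

    abstractTs : ∀ {n} → Vec Term n → Vec Term n
    abstractTs []       = []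
    abstractTs (t ∷ ts) = abstractT t ∷ abstractTs ts

  abstractA : Atom → Atom
  abstractA (rel p ts) = rel p (abstractTs ts)
  abstractA (r ≐ s)    = abstractT r ≐ abstractT s

  mutual
    abstractT-parFree : ∀ t → ParFreeT (abstractT t)
    abstractT-parFree (fun f ts) a o = abstractTs-parFree ts a o

    abstractTs-parFree : ∀ {n} (ts : Vec Term n) a → ¬ ParInTs a (abstractTs ts)
    abstractTs-parFree (t ∷ ts) a (inj₁ o) = abstractT-parFree t a o
    abstractTs-parFree (t ∷ ts) a (inj₂ o) = abstractTs-parFree ts a o

  abstractA-parFree : ∀ A a → ¬ ParInA a (abstractA A)
  abstractA-parFree (rel p ts) a o        = abstractTs-parFree ts a o
  abstractA-parFree (r ≐ s)    a (inj₁ o) = abstractT-parFree r a o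
  abstractA-parFree (r ≐ s)    a (inj₂ o) = abstractT-parFree s a o

  mutual
    groundT-abstractT : ∀ t → PureT t → groundT ℕ.pred (abstractT t) ≡ t
    groundT-abstractT (var y)    pure = ⊥-elim (pure y refl)
    groundT-abstractT (par a)    pure = refl
    groundT-abstractT (con c)    pure = refl
    groundT-abstractT (fun f ts) pure = cong (fun f) (groundTs-abstractTs ts pure)

    groundTs-abstractTs : ∀ {n} (ts : Vec Term n) → (∀ z → ¬ VarInTs z ts) → groundTs ℕ.pred (abstractTs ts) ≡ ts
    groundTs-abstractTs []       pure = refl
    groundTs-abstractTs (t ∷ ts) pure =
      cong₂ _∷_ (groundT-abstractT t (∘inj₁ pure)) (groundTs-abstractTs ts (∘inj₂ pure))

  mutual
    groundT-abstract-subst : ∀ r t → PureT r → (∀ z → VarInT z t → z ≡ 0) →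
                             groundT ℕ.pred (substT 0 (abstractT r) (abstractT t)) ≡ substT 0 r t
    groundT-abstract-subst r (var y) pure only0 with only0 y refl
    ... | refl = groundT-abstractT r pure
    groundT-abstract-subst r (par a)    pure only0 = refl
    groundT-abstract-subst r (con c)    pure only0 = refl
    groundT-abstract-subst r (fun f ts) pure only0 = cong (fun f) (groundTs-abstract-subst r ts pure only0)

    groundTs-abstract-subst : ∀ {n} r (ts : Vec Term n) → PureT r → (∀ z → VarInTs z ts → z ≡ 0) →
                              groundTs ℕ.pred (substTs 0 (abstractT r) (abstractTs ts)) ≡ substTs 0 r ts
    groundTs-abstract-subst r []       pure only0 = refl
    groundTs-abstract-subst r (t ∷ ts) pure only0 =
      cong₂ _∷_ (groundT-abstract-subst r t pure (∘inj₁ only0)) (groundTs-abstract-subst r ts pure (∘inj₂ only0))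

  groundA-abstract-subst : ∀ r A → PureT r → (∀ z → VarInA z A → z ≡ 0) →
                           groundA ℕ.pred (substA 0 (abstractT r) (abstractA A)) ≡ substA 0 r A
  groundA-abstract-subst r (rel p ts) pure only0 = cong (rel p) (groundTs-abstract-subst r ts pure only0)
  groundA-abstract-subst r (t ≐ u)    pure only0 =
    cong₂ _≐_ (groundT-abstract-subst r t pure (∘inj₁ only0)) (groundT-abstract-subst r u pure (∘inj₂ only0))

  ⊢-refl : ∀ {Γ} t → PureT t → Γ ⊢ atom (t ≐ t)
  ⊢-refl {Γ} t pure =
    subst (Γ ⊢_) (cong₂ (λ a b → atom (a ≐ b)) (groundT-abstractT t pure) (groundT-abstractT t pure))
      (⊢-closure-elim ℕ.pred (atom (abstractT t ≐ abstractT t)) tt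
        (eqax (ax-refl (abstractT t) (abstractT-parFree t))))

  ⊢-replace : ∀ {Γ} r s A → PureT r → PureT s → (∀ z → VarInA z A → z ≡ 0) →
              Γ ⊢ atom (r ≐ s) → Γ ⊢ atom (substA 0 r A) → Γ ⊢ atom (substA 0 s A)
  ⊢-replace {Γ} r s A pr ps only0 r≐s A[r] = ⇒E (⇒E axiom r≐s) A[r]
    where
    G = atom (abstractT r ≐ abstractT s) ⇒f
          (atom (substA 0 (abstractT r) (abstractA A)) ⇒f atom (substA 0 (abstractT s) (abstractA A)))
    groundG : groundF ℕ.pred G ≡ (atom (r ≐ s) ⇒f (atom (substA 0 r A) ⇒f atom (substA 0 s A)))
    groundG = cong₂ _⇒f_ (cong₂ (λ a b → atom (a ≐ b)) (groundT-abstractT r pr) (groundT-abstractT s ps))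
                         (cong₂ _⇒f_ (cong atom (groundA-abstract-subst r A pr only0))
                                     (cong atom (groundA-abstract-subst s A ps only0)))
    axiom : Γ ⊢ (atom (r ≐ s) ⇒f (atom (substA 0 r A) ⇒f atom (substA 0 s A)))
    axiom = subst (Γ ⊢_) groundG (⊢-closure-elim ℕ.pred G (tt , tt , tt)
              (eqax (ax-subst (abstractT r) (abstractT s) 0 (atom (abstractA A))
                              (abstractT-parFree r) (abstractT-parFree s) (abstractA-parFree A) tt tt)))

  substT-pure : ∀ u r → PureT r → substT 0 u r ≡ r
  substT-pure u r pure = substT-nonfree 0 u r (pure 0)

  All⇒noVarInTs : ∀ {n} (ts : Vec Term n) → VAll.All PureT ts → ∀ z → ¬ VarInTs z ts
  All⇒noVarInTs (t ∷ ts) (p VAll.∷ ps) z (inj₁ o) = p z o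
  All⇒noVarInTs (t ∷ ts) (p VAll.∷ ps) z (inj₂ o) = All⇒noVarInTs ts ps z o

  substTs-pure : ∀ {n} u (ts : Vec Term n) → VAll.All PureT ts → substTs 0 u ts ≡ ts
  substTs-pure u ts ps = substTs-nonfree 0 u ts (All⇒noVarInTs ts ps 0)

  ⊢-sym : ∀ {Γ} r s → PureT r → PureT s → Γ ⊢ atom (r ≐ s) → Γ ⊢ atom (s ≐ r)
  ⊢-sym {Γ} r s pr ps r≐s =
    subst (λ u → Γ ⊢ atom (s ≐ u)) (substT-pure s r pr)
      (⊢-replace r s (var 0 ≐ r) pr ps only0 r≐s
        (subst (λ u → Γ ⊢ atom (r ≐ u)) (sym (substT-pure r r pr)) (⊢-refl r pr)))
    where
    only0 : ∀ z → VarInA z (var 0 ≐ r) → z ≡ 0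
    only0 z (inj₁ z≡0) = z≡0
    only0 z (inj₂ o)   = ⊥-elim (pr z o)

  ⊢-trans : ∀ {Γ} r s t → PureT r → PureT s → PureT t → Γ ⊢ atom (r ≐ s) → Γ ⊢ atom (s ≐ t) → Γ ⊢ atom (r ≐ t)
  ⊢-trans {Γ} r s t pr ps pt r≐s s≐t =
    subst (λ u → Γ ⊢ atom (u ≐ t)) (substT-pure t r pr)
      (⊢-replace s t (r ≐ var 0) ps pt only0 s≐t (subst (λ u → Γ ⊢ atom (u ≐ s)) (sym (substT-pure s r pr)) r≐s))
    where
    only0 : ∀ z → VarInA z (r ≐ var 0) → z ≡ 0
    only0 z (inj₁ o)   = ⊥-elim (pr z o)
    only0 z (inj₂ z≡0) = z≡0

  ⊢-replace-args : ∀ {Γ k} (B : Vec Term k → Atom) →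
                   (∀ u ys → substA 0 u (B ys) ≡ B (substTs 0 u ys)) →
                   (∀ z ys → VarInA z (B ys) → VarInTs z ys) →
                   (rs ss : Vec Term k) → VAll.All PureT rs → VAll.All PureT ss →
                   Pointwise (λ r s → Γ ⊢ atom (r ≐ s)) rs ss → Γ ⊢ atom (B rs) → Γ ⊢ atom (B ss)
  ⊢-replace-args B _ _ [] [] _ _ [] d = d
  ⊢-replace-args {Γ} B B-subst B-vars (r ∷ rs) (s ∷ ss) (pr VAll.∷ prs) (ps VAll.∷ pss) (r≐s ∷ rs≐ss) d =
    ⊢-replace-args (λ ys → B (s ∷ ys)) B-subst' B-vars' rs ss prs pss rs≐ss B[s,rs]
    where
    A = B (var 0 ∷ rs)
    A[_] : ∀ u → substA 0 u A ≡ B (u ∷ rs)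
    A[ u ] = trans (B-subst u (var 0 ∷ rs)) (cong (λ zs → B (u ∷ zs)) (substTs-pure u rs prs))
    only0 : ∀ z → VarInA z A → z ≡ 0
    only0 z o with B-vars z _ o
    ... | inj₁ z≡0 = z≡0
    ... | inj₂ q   = ⊥-elim (All⇒noVarInTs rs prs z q)
    B[s,rs] : Γ ⊢ atom (B (s ∷ rs))
    B[s,rs] = subst (λ X → Γ ⊢ atom X) A[ s ]
                (⊢-replace r s A pr ps only0 r≐s (subst (λ X → Γ ⊢ atom X) (sym A[ r ]) d))
    B-subst' : ∀ u ys → substA 0 u (B (s ∷ ys)) ≡ B (s ∷ substTs 0 u ys)
    B-subst' u ys = trans (B-subst u (s ∷ ys)) (cong (λ w → B (w ∷ substTs 0 u ys)) (substT-pure u s ps))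
    B-vars' : ∀ z ys → VarInA z (B (s ∷ ys)) → VarInTs z ys
    B-vars' z ys o with B-vars z _ o
    ... | inj₁ q = ⊥-elim (ps z q)
    ... | inj₂ q = q

  ⊢-fun-cong : ∀ {Γ} f (rs ss : Vec Term (funArity f)) → VAll.All PureT rs → VAll.All PureT ss →
               Pointwise (λ r s → Γ ⊢ atom (r ≐ s)) rs ss → Γ ⊢ atom (fun f rs ≐ fun f ss)
  ⊢-fun-cong f rs ss prs pss rs≐ss =
    ⊢-replace-args (λ ys → fun f rs ≐ fun f ys) (λ u ys → cong (λ w → w ≐ fun f (substTs 0 u ys)) (fun-pure u))
                   vars rs ss prs pss rs≐ss (⊢-refl (fun f rs) (All⇒noVarInTs rs prs))
    where
    fun-pure : ∀ u → substT 0 u (fun f rs) ≡ fun f rs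
    fun-pure u = cong (fun f) (substTs-pure u rs prs)
    vars : ∀ z ys → VarInA z (fun f rs ≐ fun f ys) → VarInTs z ys
    vars z ys (inj₁ o) = ⊥-elim (All⇒noVarInTs rs prs z o)
    vars z ys (inj₂ o) = o

  ⊢-rel-cong : ∀ {Γ} p (rs ss : Vec Term (relArity p)) → VAll.All PureT rs → VAll.All PureT ss →
               Pointwise (λ r s → Γ ⊢ atom (r ≐ s)) rs ss → Γ ⊢ atom (rel p rs) → Γ ⊢ atom (rel p ss)
  ⊢-rel-cong p = ⊢-replace-args (rel p) (λ u ys → refl) (λ z ys → id)

  mutual
    maxParT : Term → ℕ
    maxParT (var y)    = 0
    maxParT (par a)    = a
    maxParT (con c)    = 0
    maxParT (fun f ts) = maxParTs ts

    maxParTs : ∀ {n} → Vec Term n → ℕ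
    maxParTs []       = 0
    maxParTs (t ∷ ts) = maxParT t ⊔ maxParTs ts

  maxParA : Atom → ℕ
  maxParA (rel p ts) = maxParTs ts
  maxParA (r ≐ s)    = maxParT r ⊔ maxParT s

  maxParF : Formula → ℕ
  maxParF (atom A) = maxParA A
  maxParF ⊥f       = 0
  maxParF (F ∧f G) = maxParF F ⊔ maxParF G
  maxParF (F ∨f G) = maxParF F ⊔ maxParF G
  maxParF (F ⇒f G) = maxParF F ⊔ maxParF G
  maxParF (∀f x H) = maxParF H
  maxParF (∃f x H) = maxParF H

  maxParCtx : Ctx → ℕ
  maxParCtx []      = 0
  maxParCtx (G ∷ Γ) = maxParF G ⊔ maxParCtx Γ

  mutual
    ParInT⇒≤maxParT : ∀ a t → ParInT a t → a ≤ maxParT t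
    ParInT⇒≤maxParT a (par b)    refl = ≤-refl
    ParInT⇒≤maxParT a (fun f ts) o    = ParInTs⇒≤maxParTs a ts o

    ParInTs⇒≤maxParTs : ∀ {n} a (ts : Vec Term n) → ParInTs a ts → a ≤ maxParTs ts
    ParInTs⇒≤maxParTs a (t ∷ ts) (inj₁ o) = m≤n⇒m≤n⊔o (maxParTs ts) (ParInT⇒≤maxParT a t o)
    ParInTs⇒≤maxParTs a (t ∷ ts) (inj₂ o) = m≤n⇒m≤o⊔n (maxParT t) (ParInTs⇒≤maxParTs a ts o)

  ParInA⇒≤maxParA : ∀ a A → ParInA a A → a ≤ maxParA A
  ParInA⇒≤maxParA a (rel p ts) o        = ParInTs⇒≤maxParTs a ts o
  ParInA⇒≤maxParA a (r ≐ s)    (inj₁ o) = m≤n⇒m≤n⊔o (maxParT s) (ParInT⇒≤maxParT a r o)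
  ParInA⇒≤maxParA a (r ≐ s)    (inj₂ o) = m≤n⇒m≤o⊔n (maxParT r) (ParInT⇒≤maxParT a s o)

  ParInF⇒≤maxParF : ∀ a F → ParInF a F → a ≤ maxParF F
  ParInF⇒≤maxParF a (atom A) o        = ParInA⇒≤maxParA a A o
  ParInF⇒≤maxParF a (F ∧f G) (inj₁ o) = m≤n⇒m≤n⊔o (maxParF G) (ParInF⇒≤maxParF a F o)
  ParInF⇒≤maxParF a (F ∧f G) (inj₂ o) = m≤n⇒m≤o⊔n (maxParF F) (ParInF⇒≤maxParF a G o)
  ParInF⇒≤maxParF a (F ∨f G) (inj₁ o) = m≤n⇒m≤n⊔o (maxParF G) (ParInF⇒≤maxParF a F o)
  ParInF⇒≤maxParF a (F ∨f G) (inj₂ o) = m≤n⇒m≤o⊔n (maxParF F) (ParInF⇒≤maxParF a G o)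
  ParInF⇒≤maxParF a (F ⇒f G) (inj₁ o) = m≤n⇒m≤n⊔o (maxParF G) (ParInF⇒≤maxParF a F o)
  ParInF⇒≤maxParF a (F ⇒f G) (inj₂ o) = m≤n⇒m≤o⊔n (maxParF F) (ParInF⇒≤maxParF a G o)
  ParInF⇒≤maxParF a (∀f x H) o        = ParInF⇒≤maxParF a H o
  ParInF⇒≤maxParF a (∃f x H) o        = ParInF⇒≤maxParF a H o

  maxParF≤maxParCtx : ∀ {G Γ} → G ∈ Γ → maxParF G ≤ maxParCtx Γ
  maxParF≤maxParCtx {G} {_ ∷ Γ}  (here refl) = m≤m⊔n (maxParF G) (maxParCtx Γ)
  maxParF≤maxParCtx {G} {G' ∷ Γ} (there m)   = m≤n⇒m≤o⊔n (maxParF G') (maxParF≤maxParCtx m)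

  fresh : Ctx → ℕ
  fresh Γ = suc (maxParCtx Γ)

  fresh-NotInCtx : ∀ Γ → NotInCtx (npar (fresh Γ)) Γ
  fresh-NotInCtx Γ G m o = 1+n≰n (≤-trans (ParInF⇒≤maxParF _ G o) (maxParF≤maxParCtx m))

  -- The ways of analysing a member of a set: k is the parameter for ∀ and ¬∃ at the current stage,
  -- a a fresh one for ∃ and ¬∀.  A ⇒ B is analysed as B, or as ¬A together with an analysis of
  -- ¬A; since ¬A is A ⇒ ⊥, this also analyses negations.
  negAlts : Formula → ℕ → ℕ → List (List Formula)
  negAlts (atom A) k a = [] ∷ []
  negAlts ⊥f       k a = [] ∷ []
  negAlts (C ∧f D) k a = (¬f C ∷ []) ∷ (¬f D ∷ []) ∷ []
  negAlts (C ∨f D) k a = (¬f C ∷ ¬f D ∷ []) ∷ []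
  negAlts (C ⇒f D) k a = (C ∷ ¬f D ∷ []) ∷ []
  negAlts (∀f x K) k a = (¬f (substF x (par a) K) ∷ []) ∷ []
  negAlts (∃f x K) k a = (¬f (substF x (par k) K) ∷ []) ∷ []

  alts : Formula → ℕ → ℕ → List (List Formula)
  alts (atom A) k a = [] ∷ []
  alts ⊥f       k a = [] ∷ []
  alts (A ∧f B) k a = (A ∷ B ∷ []) ∷ []
  alts (A ∨f B) k a = (A ∷ []) ∷ (B ∷ []) ∷ []
  alts (A ⇒f B) k a = (B ∷ []) ∷ map (_++ ¬f A ∷ []) (negAlts A k a)
  alts (∀f x H) k a = (substF x (par k) H ∷ []) ∷ []
  alts (∃f x H) k a = (substF x (par a) H ∷ []) ∷ []

  Consistent : Ctx → Set
  Consistent Γ = ¬ (Γ ⊢ ⊥f)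

  SomeConsistent : List (List Formula) → Ctx → Set
  SomeConsistent Ls Γ = Any (λ L → Consistent (L ++ Γ)) Ls

  inconsistent : ∀ {Γ} → ¬ Consistent Γ → Γ ⊢ ⊥f
  inconsistent {Γ} ¬c with em {Γ ⊢ ⊥f}
  ... | yes d = d
  ... | no c  = ⊥-elim (¬c c)

  one-consistent : ∀ {Γ L} → Consistent Γ → ((L ++ Γ) ⊢ ⊥f → Γ ⊢ ⊥f) → SomeConsistent (L ∷ []) Γ
  one-consistent c reduce = here (c ∘ reduce)

  two-consistent : ∀ {Γ L₁ L₂} → Consistent Γ → ((L₁ ++ Γ) ⊢ ⊥f → (L₂ ++ Γ) ⊢ ⊥f → Γ ⊢ ⊥f) →
                   SomeConsistent (L₁ ∷ L₂ ∷ []) Γ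
  two-consistent {Γ} {L₁} c reduce with em {Consistent (L₁ ++ Γ)}
  ... | yes c₁ = here c₁
  ... | no ¬c₁ = there (here (c ∘ reduce (inconsistent ¬c₁)))

  hyp₀ : ∀ {A Γ} → (A ∷ Γ) ⊢ A
  hyp₀ = hyp (here refl)

  negAlts-consistent : ∀ Γ A k a → Consistent Γ → ¬f A ∈ Γ → NotInCtx (npar a) Γ → SomeConsistent (negAlts A k a) Γ
  negAlts-consistent Γ (atom B) k a c m a∉Γ = here c
  negAlts-consistent Γ ⊥f       k a c m a∉Γ = here c
  negAlts-consistent Γ (C ∧f D) k a c m a∉Γ = two-consistent c λ d₁ d₂ → ⇒E (hyp m) (∧I (raa d₁) (raa d₂))
  negAlts-consistent Γ (C ∨f D) k a c m a∉Γ = one-consistent c λ d → ⇒E (⇒E (⇒I (⇒I d)) ¬D) ¬C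
    where
    ¬C : Γ ⊢ ¬f C
    ¬C = ⇒I (⇒E (hyp (there m)) (∨I₁ hyp₀))
    ¬D : Γ ⊢ ¬f D
    ¬D = ⇒I (⇒E (hyp (there m)) (∨I₂ hyp₀))
  negAlts-consistent Γ (C ⇒f D) k a c m a∉Γ = one-consistent c λ d → ⇒E (⇒E (⇒I (⇒I d)) ¬D) C'
    where
    C' : Γ ⊢ C
    C' = raa (⇒E (hyp (there m)) (⇒I (raa (⇒E (hyp (there (there (here refl)))) (hyp (there (here refl)))))))
    ¬D : Γ ⊢ ¬f D
    ¬D = ⇒I (⇒E (hyp (there m)) (⇒I (hyp (there (here refl)))))
  negAlts-consistent Γ (∀f x K) k a c m a∉Γ =
    one-consistent c λ d → ⇒E (hyp m) (∀I (npar a) (par-freeFor a x K) (λ o → a∉Γ _ m (inj₁ o)) a∉Γ (raa d))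
  negAlts-consistent Γ (∃f x K) k a c m a∉Γ =
    one-consistent c λ d → ⇒E (⇒I d) (⇒I (⇒E (hyp (there m)) (∃I (npar k) (par-freeFor k x K) hyp₀)))

  alts-consistent : ∀ Γ φ k → Consistent Γ → φ ∈ Γ → SomeConsistent (alts φ k (fresh Γ)) Γ
  alts-consistent Γ (atom A) k c m = here c
  alts-consistent Γ ⊥f       k c m = here c
  alts-consistent Γ (A ∧f B) k c m = one-consistent c λ d → ⇒E (⇒E (⇒I (⇒I d)) (∧E₂ (hyp m))) (∧E₁ (hyp m))
  alts-consistent Γ (A ∨f B) k c m = two-consistent c (∨E (hyp m))
  alts-consistent Γ (A ⇒f B) k c m with em {Consistent (B ∷ Γ)}
  ... | yes cB = here cB
  ... | no ¬cB = there (map⁺ (Any.map reassociate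
                  (negAlts-consistent (¬f A ∷ Γ) A k (fresh Γ) c¬A (here refl) fresh-¬A)))
    where
    c¬A : Consistent (¬f A ∷ Γ)
    c¬A d = c (⇒E (⇒I (inconsistent ¬cB)) (⇒E (hyp m) (raa d)))
    fresh-¬A : NotInCtx (npar (fresh Γ)) (¬f A ∷ Γ)
    fresh-¬A _ (here refl) (inj₁ o) = fresh-NotInCtx Γ _ m (inj₁ o)
    fresh-¬A G (there m')  o        = fresh-NotInCtx Γ G m' o
    reassociate : ∀ {L} → Consistent (L ++ ¬f A ∷ Γ) → Consistent ((L ++ ¬f A ∷ []) ++ Γ)
    reassociate {L} = subst Consistent (sym (++-assoc L (¬f A ∷ []) Γ))
  alts-consistent Γ (∀f x H) k c m = one-consistent c λ d → ⇒E (⇒I d) (∀E (npar k) (par-freeFor k x H) (hyp m))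
  alts-consistent Γ (∃f x H) k c m =
    one-consistent c λ d → ∃E (npar a) (par-freeFor a x H) (fresh-NotInCtx Γ _ m) (λ ()) (fresh-NotInCtx Γ) (hyp m) d
    where a = fresh Γ

  choose : List (List Formula) → Ctx → Ctx
  choose []       Γ = Γ
  choose (L ∷ Ls) Γ with em {Consistent (L ++ Γ)}
  ... | yes _ = L ++ Γ
  ... | no _  = choose Ls Γ

  choose-consistent : ∀ Ls Γ → SomeConsistent Ls Γ →
                      Σ (List Formula) λ L → L ∈ Ls × choose Ls Γ ≡ L ++ Γ × Consistent (L ++ Γ)
  choose-consistent (L ∷ Ls) Γ some with em {Consistent (L ++ Γ)}
  ... | yes c = L , here refl , refl , c
  choose-consistent (L ∷ Ls) Γ (here c)     | no ¬c = ⊥-elim (¬c c)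
  choose-consistent (L ∷ Ls) Γ (there some) | no _  =
    Prod.map₂ (Prod.map₁ there) (choose-consistent Ls Γ some)

  Analysed : Formula → ℕ → Ctx → Set
  Analysed φ k Δ = Σ ℕ λ a → Σ (List Formula) λ L → L ∈ alts φ k a × L ⊆ Δ

  Analysed-⊆ : ∀ {φ k Δ Δ'} → Δ ⊆ Δ' → Analysed φ k Δ → Analysed φ k Δ'
  Analysed-⊆ Δ⊆Δ' (a , L , L∈ , L⊆Δ) = a , L , L∈ , Δ⊆Δ' ∘ L⊆Δ

  analyse : Ctx → Formula × ℕ → Ctx
  analyse Γ (φ , k) = choose (alts φ k (fresh Γ)) Γ

  analyseAll : List (Formula × ℕ) → Ctx → Ctx
  analyseAll []       Γ = Γ
  analyseAll (t ∷ ts) Γ = analyseAll ts (analyse Γ t)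

  record Analysis (ts : List (Formula × ℕ)) (Γ Δ : Ctx) : Set where
    field
      consistent : Consistent Δ
      extends    : Γ ⊆ Δ
      analysed   : ∀ {φ k} → (φ , k) ∈ ts → Analysed φ k Δ

  analyse-ok : ∀ Γ φ k → Consistent Γ → φ ∈ Γ → Analysis ((φ , k) ∷ []) Γ (analyse Γ (φ , k))
  analyse-ok Γ φ k c φ∈Γ with choose-consistent (alts φ k (fresh Γ)) Γ (alts-consistent Γ φ k c φ∈Γ)
  ... | L , L∈ , chosen , c' rewrite chosen = record
    { consistent = c'
    ; extends    = ∈-++⁺ʳ L
    ; analysed   = λ { (here refl) → fresh Γ , L , L∈ , ∈-++⁺ˡ }
    }

  analyseAll-ok : ∀ ts Γ → Consistent Γ → (∀ {φ k} → (φ , k) ∈ ts → φ ∈ Γ) → Analysis ts Γ (analyseAll ts Γ)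
  analyseAll-ok [] Γ c _ = record { consistent = c ; extends = id ; analysed = λ () }
  analyseAll-ok ((φ , k) ∷ ts) Γ c ts⊆Γ = record
    { consistent = consistent rest
    ; extends    = extends rest ∘ extends first
    ; analysed   = λ { (here refl) → Analysed-⊆ (extends rest) (analysed first (here refl))
                     ; (there t∈) → analysed rest t∈ }
    }
    where
    open Analysis
    first = analyse-ok Γ φ k c (ts⊆Γ (here refl))
    rest  = analyseAll-ok ts (analyse Γ (φ , k)) (consistent first) (extends first ∘ ts⊆Γ ∘ there)

  module Chain (Γ₀ : Ctx) (c₀ : Consistent Γ₀) where

    tasks : Ctx → ℕ → List (Formula × ℕ)
    tasks Γ n = cartesianProduct Γ (upTo (suc n))

    stage : ℕ → Ctx
    stage zero    = Γ₀
    stage (suc n) = analyseAll (tasks (stage n) n) (stage n)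

    stage-consistent : ∀ n → Consistent (stage n)
    stage-step : ∀ n → Analysis (tasks (stage n) n) (stage n) (stage (suc n))
    stage-step n = analyseAll-ok _ _ (stage-consistent n) (proj₁ ∘ ∈-cartesianProduct⁻ _ _)
    stage-consistent zero    = c₀
    stage-consistent (suc n) = Analysis.consistent (stage-step n)

    stage-⊆′ : ∀ {n m} → n ≤′ m → stage n ⊆ stage m
    stage-⊆′ (≤′-reflexive refl) = id
    stage-⊆′ (≤′-step {m} n≤′m)  = Analysis.extends (stage-step m) ∘ stage-⊆′ n≤′m

    stage-⊆ : ∀ {n m} → n ≤ m → stage n ⊆ stage m
    stage-⊆ = stage-⊆′ ∘ ≤⇒≤′

    InUnion : Formula → Set
    InUnion φ = Σ ℕ λ n → φ ∈ stage n

    InUnion-⊆ : List Formula → Set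
    InUnion-⊆ L = ∀ {X} → X ∈ L → InUnion X

    ⊥∉union : ¬ InUnion ⊥f
    ⊥∉union (n , m) = stage-consistent n (hyp m)

    InUnion-analysed : ∀ {φ} → InUnion φ → ∀ k → Σ ℕ λ a → Σ (List Formula) λ L → L ∈ alts φ k a × InUnion-⊆ L
    InUnion-analysed (n , m) k with Analysis.analysed (stage-step (n ⊔ k))
                                      (∈-cartesianProduct⁺ (stage-⊆ (m≤m⊔n n k) m) (∈-upTo⁺ (s≤s (m≤n⊔m n k))))
    ... | a , L , L∈ , L⊆ = a , L , L∈ , λ X∈L → suc (n ⊔ k) , L⊆ X∈L

    InUnion-⇒ : ∀ {A B} → InUnion (A ⇒f B) → InUnion B ⊎ InUnion (¬f A)
    InUnion-⇒ {A} h with InUnion-analysed h 0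
    ... | a , _ , here refl , L⊆ = inj₁ (L⊆ (here refl))
    ... | a , _ , there L∈ , L⊆ with ∈-map⁻ _ L∈
    ...   | L' , _ , refl = inj₂ (L⊆ (∈-++⁺ʳ L' (here refl)))

    InUnion-negAnalysed : ∀ {φ} → InUnion (¬f φ) → ∀ k →
                          Σ ℕ λ a → Σ (List Formula) λ L → L ∈ negAlts φ k a × InUnion-⊆ L
    InUnion-negAnalysed h k with InUnion-analysed h k
    ... | a , _ , here refl , L⊆ = ⊥-elim (⊥∉union (L⊆ (here refl)))
    ... | a , _ , there L∈ , L⊆ with ∈-map⁻ _ L∈
    ...   | L' , L'∈ , refl = a , L' , L'∈ , L⊆ ∘ ∈-++⁺ˡ

    Eventually : (ℕ → Set) → Set
    Eventually P = Σ ℕ λ n → ∀ m → n ≤ m → P m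

    Eventually-map : ∀ {P Q : ℕ → Set} → (∀ {m} → P m → Q m) → Eventually P → Eventually Q
    Eventually-map f (n , p) = n , λ m n≤m → f (p m n≤m)

    Eventually-zip : ∀ {P Q : ℕ → Set} → Eventually P → Eventually Q → Eventually (λ m → P m × Q m)
    Eventually-zip (n₁ , p) (n₂ , q) =
      n₁ ⊔ n₂ , λ m le → p m (≤-trans (m≤m⊔n n₁ n₂) le) , q m (≤-trans (m≤n⊔m n₁ n₂) le)

    -- Asking for derivability at all later stages avoids the need for weakening of ⊢.
    EventuallyDerivable : Atom → Set
    EventuallyDerivable A = Eventually λ m → stage m ⊢ atom A

    val : Valuation
    val A = ⌊ em {EventuallyDerivable A} ⌋

    Truth : ℕ → Formula → Set
    Truth n φ = (InUnion φ → evalN val n φ) × (InUnion (¬f φ) → ¬ evalN val n φ)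

    truth-atom : ∀ n A → Truth n (atom A)
    truth-atom n A = (λ (k , m) → fromWitness (k , λ j k≤j → hyp (stage-⊆ k≤j m))) , refute
      where
      refute : InUnion (¬f (atom A)) → ¬ T (val A)
      refute (k , m) t with Eventually-zip (k , λ j k≤j → stage-⊆ k≤j m) (toWitness t)
      ... | n₀ , both = let ¬A∈ , A = both n₀ ≤-refl in stage-consistent n₀ (⇒E (hyp ¬A∈) A)

    truth-⊥ : ∀ n → Truth n ⊥f
    truth-⊥ n = ⊥∉union , λ _ → id

    truth-∧ : ∀ {n A B} → Truth n A → Truth n B → Truth (suc n) (A ∧f B)
    truth-∧ {n} {A} {B} (A⁺ , A⁻) (B⁺ , B⁻) = pos , neg
      where
      pos : InUnion (A ∧f B) → evalN val (suc n) (A ∧f B)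
      pos h with InUnion-analysed h 0
      ... | _ , _ , here refl , L⊆ = A⁺ (L⊆ (here refl)) , B⁺ (L⊆ (there (here refl)))
      neg : InUnion (¬f (A ∧f B)) → ¬ evalN val (suc n) (A ∧f B)
      neg h (a , b) with InUnion-negAnalysed h 0
      ... | _ , _ , here refl ,         L⊆ = A⁻ (L⊆ (here refl)) a
      ... | _ , _ , there (here refl) , L⊆ = B⁻ (L⊆ (here refl)) b

    truth-∨ : ∀ {n A B} → Truth n A → Truth n B → Truth (suc n) (A ∨f B)
    truth-∨ {n} {A} {B} (A⁺ , A⁻) (B⁺ , B⁻) = pos , neg
      where
      pos : InUnion (A ∨f B) → evalN val (suc n) (A ∨f B)
      pos h with InUnion-analysed h 0
      ... | _ , _ , here refl ,         L⊆ = inj₁ (A⁺ (L⊆ (here refl)))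
      ... | _ , _ , there (here refl) , L⊆ = inj₂ (B⁺ (L⊆ (here refl)))
      neg : InUnion (¬f (A ∨f B)) → ¬ evalN val (suc n) (A ∨f B)
      neg h ab with InUnion-negAnalysed h 0
      ... | _ , _ , here refl , L⊆ = Sum.[ A⁻ (L⊆ (here refl)) , B⁻ (L⊆ (there (here refl))) ] ab

    truth-⇒ : ∀ {n A B} → Truth n A → Truth n B → Truth (suc n) (A ⇒f B)
    truth-⇒ {n} {A} {B} (A⁺ , A⁻) (B⁺ , B⁻) = pos , neg
      where
      pos : InUnion (A ⇒f B) → evalN val (suc n) (A ⇒f B)
      pos h with InUnion-⇒ h
      ... | inj₁ B∈ = λ _ → B⁺ B∈
      ... | inj₂ ¬A∈ = ⊥-elim ∘ A⁻ ¬A∈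
      neg : InUnion (¬f (A ⇒f B)) → ¬ evalN val (suc n) (A ⇒f B)
      neg h a→b with InUnion-negAnalysed h 0
      ... | _ , _ , here refl , L⊆ = B⁻ (L⊆ (there (here refl))) (a→b (A⁺ (L⊆ (here refl))))

    truth-∀ : ∀ {n x H} → (∀ a → Truth n (substF x (par a) H)) → Truth (suc n) (∀f x H)
    truth-∀ {n} {x} {H} H[_] = pos , neg
      where
      pos : InUnion (∀f x H) → evalN val (suc n) (∀f x H)
      pos h k with InUnion-analysed h k
      ... | _ , _ , here refl , L⊆ = proj₁ H[ k ] (L⊆ (here refl))
      neg : InUnion (¬f (∀f x H)) → ¬ evalN val (suc n) (∀f x H)
      neg h all with InUnion-negAnalysed h 0
      ... | a , _ , here refl , L⊆ = proj₂ H[ a ] (L⊆ (here refl)) (all a)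

    truth-∃ : ∀ {n x H} → (∀ a → Truth n (substF x (par a) H)) → Truth (suc n) (∃f x H)
    truth-∃ {n} {x} {H} H[_] = pos , neg
      where
      pos : InUnion (∃f x H) → evalN val (suc n) (∃f x H)
      pos h with InUnion-analysed h 0
      ... | a , _ , here refl , L⊆ = a , proj₁ H[ a ] (L⊆ (here refl))
      neg : InUnion (¬f (∃f x H)) → ¬ evalN val (suc n) (∃f x H)
      neg h (k , Hk) with InUnion-negAnalysed h k
      ... | _ , _ , here refl , L⊆ = proj₂ H[ k ] (L⊆ (here refl)) Hk

    truth : ∀ n φ → height φ ≤ n → Truth n φ
    truth n       (atom A) _ = truth-atom n A
    truth n       ⊥f       _ = truth-⊥ n
    truth (suc n) (A ∧f B) h = truth-∧ (truth n A (⊔-boundˡ h)) (truth n B (⊔-boundʳ h))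
    truth (suc n) (A ∨f B) h = truth-∨ (truth n A (⊔-boundˡ h)) (truth n B (⊔-boundʳ h))
    truth (suc n) (A ⇒f B) h = truth-⇒ (truth n A (⊔-boundˡ h)) (truth n B (⊔-boundʳ h))
    truth (suc n) (∀f x H) h = truth-∀ λ a → truth n (substF x (par a) H) (height-instance x a H h)
    truth (suc n) (∃f x H) h = truth-∃ λ a → truth n (substF x (par a) H) (height-instance x a H h)

    pointwise-eventually : ∀ {k} (rs ss : Vec Term k) → Pointwise (λ r s → T (val (r ≐ s))) rs ss →
                           Eventually λ m → Pointwise (λ r s → stage m ⊢ atom (r ≐ s)) rs ss
    pointwise-eventually []       []       []       = 0 , λ _ _ → []
    pointwise-eventually (r ∷ rs) (s ∷ ss) (e ∷ es) =
      Eventually-map (Prod.uncurry _∷_) (Eventually-zip (toWitness e) (pointwise-eventually rs ss es))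

    val-EqValuation : ∀ L → EqValuation L val
    val-EqValuation L = record
      { eq-refl  = λ t pt → fromWitness (0 , λ _ _ → ⊢-refl t (proj₁ pt))
      ; eq-sym   = λ r s pr ps e → fromWitness (Eventually-map (⊢-sym r s (proj₁ pr) (proj₁ ps)) (toWitness e))
      ; eq-trans = λ r s t pr ps pt e₁ e₂ → fromWitness
          (Eventually-map (Prod.uncurry (⊢-trans r s t (proj₁ pr) (proj₁ ps) (proj₁ pt)))
                          (Eventually-zip (toWitness e₁) (toWitness e₂)))
      ; eq-fun   = λ f _ rs ss prs pss es → fromWitness
          (Eventually-map (⊢-fun-cong f rs ss (VAll.map proj₁ prs) (VAll.map proj₁ pss)) (pointwise-eventually rs ss es))
      ; eq-rel   = λ p _ rs ss prs pss es e → fromWitness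
          (Eventually-map (Prod.uncurry (⊢-rel-cong p rs ss (VAll.map proj₁ prs) (VAll.map proj₁ pss)))
                          (Eventually-zip (pointwise-eventually rs ss es) (toWitness e)))
      }

  completeness : ∀ Gs F → ¬ (Gs ⊢ F) →
                 Σ Valuation λ v → EqValuation (LangOf (F ∷ Gs)) v × All (Sat v) Gs × ¬ Sat v F
  completeness Gs F ⊬F =
    val , val-EqValuation _ ,
    All.tabulate (λ {G} G∈Gs → proj₁ (truth (height G) G ≤-refl) (0 , there G∈Gs)) ,
    proj₂ (truth (height F) F ≤-refl) (0 , here refl)
    where open Chain (¬f F ∷ Gs) (⊬F ∘ raa)

mainTheorem5 : ExcludedMiddle 0ℓ → (Sig : Signature) →
    let open Syntax Sig in
    (Gs : List Formula) (F : Formula) → All PureF Gs → PureF F →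
    (Gs ⊢ F) ⇔ ((v : Valuation) → EqValuation (LangOf (F ∷ Gs)) v →
                All (Sat v) Gs → Sat v F)
mainTheorem5 em Sig Gs F pureGs pureF = mk⇔ (Soundness.soundness em Sig Gs F pureGs pureF) complete
  where
  open Syntax Sig
  complete : ((v : Valuation) → EqValuation (LangOf (F ∷ Gs)) v → All (Sat v) Gs → Sat v F) → Gs ⊢ F
  complete valid with em {Gs ⊢ F}
  ... | yes ⊢F = ⊢F
  ... | no ⊬F with Completeness.completeness em Sig Gs F ⊬F
  ...   | v , eqv , satGs , ¬satF = ⊥-elim (¬satF (valid v eqv satGs))
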